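{- Let $n\ge 4$ and $k\ge 1$, and let $\mathbf{Q}_{n,k}$ be the set of all quivers $Q$ on $[1,n]$ obtained as follows: take any quiver $\tilde R$ on $[1,n-1]$ with $b_{ij}(\tilde R)\ge 2$ for all $i<j$; let the full subquiver of $Q$ on $[1,n-1]$ be the quiver obtained from $\tilde R$ by mutating successively at $2,1,2,1,\dots,2,1$ ($2k$ mutations, starting with $2$); and let $b_{in}(Q)\ge 2$ ($1\le i\le n-1$) be arbitrary. Then $\mathbf{Q}_{n,k}$ is a fully generic family of quivers. Consequently, $\mathbf{Q}_{n,k}$ together with the mutation sequence $n,\ 1,2,\dots,1,2\ (2k\text{ terms}),\ n-1,n-2,\dots,2,1,\ 2,1,\dots,2,1\ (2k\text{ terms})$ defines a fully generic mutation cycle.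
   Context: A quiver on $[1,n]$ is a finite directed multigraph with no loops and no oriented 2-cycles; quivers are labeled. It is encoded by the skew-symmetric matrix $B(Q)=(b_{ij})$, $b_{ij}>0$ meaning $b_{ij}$ arrows from $i$ to $j$. Mutation at $k$: $\mu[k](Q)$ has $b'_{ij}=-b_{ij}$ if $k\in\{i,j\}$ and $b'_{ij}=b_{ij}+\tfrac12(|b_{ik}|b_{kj}+b_{ik}|b_{kj}|)$ otherwise. The set $\mathrm{Quiv}_n$ of all quivers on $[1,n]$ is identified with $\mathbb{Z}^{\binom n2}$ via $Q\mapsto (b_{ij}(Q))_{1\le i<j\le n}$. For $A,B\subseteq\mathbb{Z}^d$, a map $f:A\to B$ is $\mathbb{Z}$-biregular if it is a bijection and both $f$ and $f^{ -1}$ are given by polynomials with integer coefficients in the coordinates. A family $\mathbf{Q}\subseteq \mathrm{Quiv}_n$ is fully generic if it contains a subset which is the image of a $\mathbb{Z}$-biregular map from $\mathbb{Z}_{\ge 0}^{\binom n2}$. A family $\mathbf{Q}$ and a sequence $i_1,\dots,i_N$ define a fully generic mutation cycle if $\mathbf{Q}$ is fully generic and for every $Q\in\mathbf{Q}$ the sequence is a mutation cycle based at $Q$, i.e. consecutive entries are distinct (cyclically), no mutation is applied at an isolated vertex, and mutating $Q$ successively at $i_1,\dots,i_N$ returns $Q$. -}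

module Defs where

open import Level using (Level)
open import Data.Nat using (ℕ; zero; suc; _<_)
open import Data.Nat.Properties using (<-cmp)
open import Data.Fin using (Fin; toℕ; fromℕ; inject₁) renaming (zero to fz; suc to fs)
open import Data.Integer using (ℤ; +_; -_; _+_; _*_; _≤_; ∣_∣)
open import Data.Integer.DivMod using (_/ℕ_)
open import Data.List using (List; []; _∷_; _++_; [_]; concat; replicate; reverse; map; allFin)
open import Data.Product using (Σ; Σ-syntax; _×_; _,_; proj₁)
open import Data.Unit using (⊤)
open import Data.Empty using (⊥)
open import Relation.Binary.PropositionalEquality using (_≡_; _≢_)
open import Relation.Binary.Definitions using (tri<; tri≈; tri>)
open import Relation.Nullary using (¬_; yes; no)
open import Data.Fin using (_≟_)
open import Data.Bool using (Bool; true; false; if_then_else_; _∨_)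
open import Relation.Nullary.Decidable using (⌊_⌋)

-- Coordinates: pairs (i , j) of vertices with i < j.  Vertex "label" l
-- in [1,n] is the element of Fin n with toℕ = l - 1.

Coord : ℕ → Set
Coord n = Σ[ ij ∈ Fin n × Fin n ] (toℕ (proj₁ ij) < toℕ (Data.Product.proj₂ ij))

-- A quiver on [1,n], identified with its coordinates (b_ij)_{i<j} ∈ ℤ^(n choose 2).
Quiv : ℕ → Set
Quiv n = Coord n → ℤ

_≈Q_ : ∀ {n} → Quiv n → Quiv n → Set
Q ≈Q R = ∀ c → Q c ≡ R c

bm : ∀ {n} → Quiv n → Fin n → Fin n → ℤ
bm Q i j with <-cmp (toℕ i) (toℕ j)
... | tri< p _ _ = Q ((i , j) , p)
... | tri≈ _ _ _ = + 0
... | tri> _ _ p = - Q ((j , i) , p)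

-- ½(|a| b + a |b|)   (an exact division: the numerator is always even)
halfTerm : ℤ → ℤ → ℤ
halfTerm a b = ((+ ∣ a ∣) * b + a * (+ ∣ b ∣)) /ℕ 2

μ : ∀ {n} → Fin n → Quiv n → Quiv n
μ k Q ((i , j) , p) =
  if ⌊ k ≟ i ⌋ ∨ ⌊ k ≟ j ⌋
  then - Q ((i , j) , p)
  else Q ((i , j) , p) + halfTerm (bm Q i k) (bm Q k j)

μs : ∀ {n} → List (Fin n) → Quiv n → Quiv n
μs [] Q = Q
μs (k ∷ ks) Q = μs ks (μ k Q)

Isolated : ∀ {n} → Quiv n → Fin n → Set
Isolated {n} Q k = ∀ (j : Fin n) → bm Q j k ≡ + 0

ConsecDistinct : ∀ {A : Set} → List A → Set
ConsecDistinct [] = ⊤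
ConsecDistinct (x ∷ []) = ⊤
ConsecDistinct (x ∷ y ∷ r) = (x ≢ y) × ConsecDistinct (y ∷ r)

CycDistinct : ∀ {A : Set} → List A → Set
CycDistinct [] = ⊤
CycDistinct (x ∷ r) = ConsecDistinct ((x ∷ r) ++ [ x ])

NoIsolatedMut : ∀ {n} → Quiv n → List (Fin n) → Set
NoIsolatedMut Q [] = ⊤
NoIsolatedMut Q (k ∷ ks) = (¬ Isolated Q k) × NoIsolatedMut (μ k Q) ks

IsMutationCycle : ∀ {n} → List (Fin n) → Quiv n → Set
IsMutationCycle ks Q = CycDistinct ks × NoIsolatedMut Q ks × (μs ks Q ≈Q Q)

data Poly (V : Set) : Set where
  var  : V → Poly V
  con  : ℤ → Poly V
  _⊕_  : Poly V → Poly V → Poly V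
  _⊗_  : Poly V → Poly V → Poly V

eval : ∀ {V} → Poly V → (V → ℤ) → ℤ
eval (var v) x = x v
eval (con c) x = c
eval (p ⊕ q) x = eval p x + eval q x
eval (p ⊗ q) x = eval p x * eval q x

PolyMap : Set → Set → Set
PolyMap V W = W → Poly V

evalMap : ∀ {V W} → PolyMap V W → (V → ℤ) → (W → ℤ)
evalMap P x w = eval (P w) x

record ZBiregular {V W : Set} (A : (V → ℤ) → Set) (B : (W → ℤ) → Set) : Set where
  field
    fwd      : PolyMap V W
    bwd      : PolyMap W V
    fwd-into : ∀ x → A x → B (evalMap fwd x)
    bwd-into : ∀ y → B y → A (evalMap bwd y)
    bwd∘fwd  : ∀ x → A x → ∀ v → evalMap bwd (evalMap fwd x) v ≡ x v
    fwd∘bwd  : ∀ y → B y → ∀ w → evalMap fwd (evalMap bwd y) w ≡ y w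

NonNeg : ∀ {V : Set} → (V → ℤ) → Set
NonNeg x = ∀ v → + 0 ≤ x v

FullyGeneric : (n : ℕ) → (Quiv n → Set) → Set₁
FullyGeneric n 𝐐 =
  Σ[ S ∈ (Quiv n → Set) ] ((∀ Q → S Q → 𝐐 Q) × ZBiregular {Coord n} {Coord n} NonNeg S)

FullyGenericMutationCycle : (n : ℕ) → (Quiv n → Set) → List (Fin n) → Set₁
FullyGenericMutationCycle n 𝐐 ks =
  FullyGeneric n 𝐐 × (∀ Q → 𝐐 Q → IsMutationCycle ks Q)

-- The family Q_{n,k} and the cycle sequence (only meaningful for n ≥ 4;
-- for n < 4 they are given trivial dummy values).

restrict : ∀ {m} → Quiv (suc m) → Quiv m
restrict {m} Q ((i , j) , p) = Q ((inject₁ i , inject₁ j) , lem)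
  where
  open import Data.Fin.Properties using (toℕ-inject₁)
  open import Relation.Binary.PropositionalEquality using (sym; subst₂)
  lem = subst₂ _<_ (sym (toℕ-inject₁ i)) (sym (toℕ-inject₁ j)) p

lastCol : ∀ {m} → Quiv (suc m) → Fin m → ℤ
lastCol {m} Q i = Q ((inject₁ i , fromℕ m) , lem)
  where
  open import Data.Fin.Properties using (toℕ-inject₁; toℕ-fromℕ; toℕ<n)
  open import Relation.Binary.PropositionalEquality using (sym; subst₂)
  lem = subst₂ _<_ (sym (toℕ-inject₁ i)) (sym (toℕ-fromℕ m)) (toℕ<n i)

𝐐 : (n k : ℕ) → Quiv n → Set
𝐐 (suc (suc (suc (suc m)))) k Q =
  Σ[ R ∈ Quiv (suc (suc (suc m))) ]
    ((∀ c → + 2 ≤ R c)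
    × (restrict Q ≈Q μs (concat (replicate k (fs fz ∷ fz ∷ []))) R)
    × (∀ i → + 2 ≤ lastCol Q i))
𝐐 _ k Q = ⊥

cycleSeq : (n k : ℕ) → List (Fin n)
cycleSeq (suc (suc (suc (suc m)))) k =
  fromℕ (suc (suc (suc m)))
  ∷ concat (replicate k (fz ∷ fs fz ∷ []))
  ++ reverse (map inject₁ (allFin (suc (suc (suc m)))))
  ++ concat (replicate k (fs fz ∷ fz ∷ []))
cycleSeq _ k = []

module Submission where

-- Split the vertices into 1, 2 and the others r, and look at the columns (b₁ᵣ, b₂ᵣ). If a = b₁₂ ≥ 0 and
-- every column satisfies b₂ᵣ ≥ 0 and b₁ᵣ + a b₂ᵣ ≥ 0, then mutating at 2 and then at 1 (a round) keeps
-- b₁₂ and all entries among the others, and applies T (c , d) = (−(c + a d), −d + a(c + a d)) to each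
-- column; for a ≥ 2, T preserves the cone 1 ≤ d ≤ c + a d. So on quivers with all entries ≥ 2, k rounds
-- act by the polynomial map Tᵏ with polynomial inverse, and Q_{n,k} is parametrized by b = 2 + x.
--
-- Along the cycle, n and then n − 1, …, 3 are sinks when mutated, so they only flip signs; the rounds
-- (1, 2) run the columns backwards and the rounds (2, 1) forwards again. In the two rounds where some
-- columns are negative instead, the column of n changes by ± a T-adjoint bilinear form, and the two
-- changes cancel.

open import Defs
open import Data.Nat using (ℕ; _≤_)
open import Data.Product using (_×_)

open import Data.Bool using (Bool; true; false; if_then_else_; not; _∨_; _xor_)
import Data.Bool.Properties as Bool
open import Data.Empty using (⊥-elim)
open import Data.Fin as Fin using (Fin; toℕ; fromℕ; inject₁) renaming (zero to fz; suc to fs)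
import Data.Fin.Properties as Fin
open import Data.Integer as ℤ using (ℤ; +_; -[1+_]; -_; _+_; _*_; 0ℤ; +≤+) renaming (_≤_ to _≤ℤ_)
open import Data.Integer.DivMod using (_/ℕ_)
import Data.Integer.Properties as ℤ
open import Data.Integer.Tactic.RingSolver using (solve-∀)
open import Data.List
  using (List; []; _∷_; _++_; [_]; _∷ʳ_; concat; replicate; reverse; map; allFin; tabulate; head; last)
import Data.List.Properties as List
open import Data.List.Relation.Unary.Linked using (Linked; []; [-]; _∷_; _∷′_)
import Data.List.Relation.Unary.Linked.Properties as Linked
import Data.List.Relation.Unary.Unique.Propositional.Properties as Unique
open import Data.Maybe using (just)
open import Data.Maybe.Relation.Binary.Connected using (Connected; just)
open import Data.Nat as ℕ using (zero; suc; z≤n; s≤s)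
import Data.Nat.DivMod as ℕ
open import Data.Nat.GeneralisedArithmetic using (fold)
import Data.Nat.Properties as ℕ
open import Data.Product using (_,_; proj₁; proj₂; ∃-syntax)
open import Data.Sum using (inj₁; inj₂)
open import Data.Unit using (⊤; tt)
open import Relation.Binary.Definitions using (tri<; tri≈; tri>)
open import Relation.Binary.PropositionalEquality hiding ([_])
open import Relation.Nullary using (yes; no)
open import Relation.Nullary.Decidable using (⌊_⌋; does; dec-true; dec-false)
open ≡-Reasoning

i≡-i⇒i≡0 : ∀ {i} → i ≡ - i → i ≡ 0ℤ
i≡-i⇒i≡0 {+ zero} _ = refl

1≤i⇒i≢0 : ∀ {i} → + 1 ≤ℤ i → i ≢ 0ℤ
1≤i⇒i≢0 (+≤+ (s≤s _)) ()

2≤i⇒1≤i : ∀ {i} → + 2 ≤ℤ i → + 1 ≤ℤ i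
2≤i⇒1≤i = ℤ.≤-trans (+≤+ (s≤s z≤n))

2≤i⇒0≤i : ∀ {i} → + 2 ≤ℤ i → 0ℤ ≤ℤ i
2≤i⇒0≤i = ℤ.≤-trans (+≤+ z≤n)

0≤i⇒2≤2+i : ∀ {i} → 0ℤ ≤ℤ i → + 2 ≤ℤ + 2 + i
0≤i⇒2≤2+i i≥0 = ℤ.i≤i+j (+ 2) _ {{ℤ.nonNegative i≥0}}

n+n≡n*2 : ∀ n → n ℕ.+ n ≡ n ℕ.* 2
n+n≡n*2 n = trans (cong (n ℕ.+_) (sym (ℕ.+-identityʳ n))) (ℕ.*-comm 2 n)

2+n+n≡[1+n]*2 : ∀ n → suc (suc (n ℕ.+ n)) ≡ suc n ℕ.* 2
2+n+n≡[1+n]*2 n = trans (cong suc (sym (ℕ.+-suc n n))) (n+n≡n*2 (suc n))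

[i+i]/ℕ2≡i : ∀ i → (i + i) /ℕ 2 ≡ i
[i+i]/ℕ2≡i (+ n) = cong +_ (trans (cong (ℕ._/ 2) (n+n≡n*2 n)) (ℕ.m*n/n≡m n 2))
-- _/ℕ_ rounds a negative dividend down, branching on the remainder (here 0).
[i+i]/ℕ2≡i -[1+ n ] with suc (suc (n ℕ.+ n)) ℕ.% 2 | 2+n+n%2≡0
  where
  2+n+n%2≡0 : suc (suc (n ℕ.+ n)) ℕ.% 2 ≡ 0
  2+n+n%2≡0 = trans (cong (ℕ._% 2) (2+n+n≡[1+n]*2 n)) (ℕ.m*n%n≡0 (suc n) 2)
... | .0 | refl = cong (λ q → - (+ q)) (trans (cong (ℕ._/ 2) (2+n+n≡[1+n]*2 n)) (ℕ.m*n/n≡m (suc n) 2))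

+∣i∣≡-i : ∀ {i} → i ≤ℤ 0ℤ → + ℤ.∣ i ∣ ≡ - i
+∣i∣≡-i {+ zero} _ = refl
+∣i∣≡-i { -[1+ n ]} _ = refl
+∣i∣≡-i {+ suc n} (+≤+ ())

module _ {A : Set} where

  fold-suc′ : ∀ (f : A → A) x n → fold x f (suc n) ≡ fold (f x) f n
  fold-suc′ f x zero = refl
  fold-suc′ f x (suc n) = cong f (fold-suc′ f x n)

  fold-inverse : ∀ {f g : A → A} → (∀ x → g (f x) ≡ x) → ∀ x n → fold (fold x f n) g n ≡ x
  fold-inverse g∘f x zero = refl
  fold-inverse {f} {g} g∘f x (suc n) = begin
    fold (f (fold x f n)) g (suc n)   ≡⟨ fold-suc′ g _ n ⟩
    fold (g (f (fold x f n))) g n     ≡⟨ cong (λ y → fold y g n) (g∘f _) ⟩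
    fold (fold x f n) g n             ≡⟨ fold-inverse g∘f x n ⟩
    x                                 ∎

  fold-preserves : ∀ (P : A → Set) {f : A → A} → (∀ {x} → P x → P (f x)) → ∀ {x} n → P x → P (fold x f n)
  fold-preserves P step zero Px = Px
  fold-preserves P step (suc n) Px = step (fold-preserves P step n Px)

  fold-map : ∀ {B : Set} (h : A → B) {f : A → A} {g : B → B} → (∀ v → h (f v) ≡ g (h v)) →
    ∀ v n → h (fold v f n) ≡ fold (h v) g n
  fold-map h commutes v zero = refl
  fold-map h {f} {g} commutes v (suc n) = trans (commutes (fold v f n)) (cong g (fold-map h commutes v n))

  fold-adjoint : ∀ {B : Set} (β : A → A → B) {f : A → A} → (∀ v w → β (f v) w ≡ β v (f w)) →
    ∀ v w n → β (fold v f n) w ≡ β v (fold w f n)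
  fold-adjoint β adj v w zero = refl
  fold-adjoint β {f} adj v w (suc n) = begin
    β (f (fold v f n)) w     ≡⟨ adj _ w ⟩
    β (fold v f n) (f w)     ≡⟨ fold-adjoint β adj v (f w) n ⟩
    β v (fold (f w) f n)     ≡⟨ cong (β v) (fold-suc′ f w n) ⟨
    β v (fold w f (suc n))   ∎

halfTerm-abs : ∀ a b {x y} → + ℤ.∣ a ∣ ≡ x → + ℤ.∣ b ∣ ≡ y → halfTerm a b ≡ (x * b + a * y) /ℕ 2
halfTerm-abs a b ∣a∣≡x ∣b∣≡y = cong₂ (λ x y → (x * b + a * y) /ℕ 2) ∣a∣≡x ∣b∣≡y

halfTerm-≥0-≥0 : ∀ {a b} → 0ℤ ≤ℤ a → 0ℤ ≤ℤ b → halfTerm a b ≡ a * b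
halfTerm-≥0-≥0 {a} {b} a≥0 b≥0 = begin
  halfTerm a b           ≡⟨ halfTerm-abs a b (ℤ.0≤i⇒+∣i∣≡i a≥0) (ℤ.0≤i⇒+∣i∣≡i b≥0) ⟩
  (a * b + a * b) /ℕ 2   ≡⟨ [i+i]/ℕ2≡i (a * b) ⟩
  a * b                  ∎

halfTerm-≤0-≤0 : ∀ {a b} → a ≤ℤ 0ℤ → b ≤ℤ 0ℤ → halfTerm a b ≡ - (a * b)
halfTerm-≤0-≤0 {a} {b} a≤0 b≤0 = begin
  halfTerm a b                      ≡⟨ halfTerm-abs a b (+∣i∣≡-i a≤0) (+∣i∣≡-i b≤0) ⟩
  ((- a) * b + a * (- b)) /ℕ 2      ≡⟨ cong₂ (λ x y → (x + y) /ℕ 2) (ℤ.neg-distribˡ-* a b) (ℤ.neg-distribʳ-* a b) ⟨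
  (- (a * b) + - (a * b)) /ℕ 2      ≡⟨ [i+i]/ℕ2≡i (- (a * b)) ⟩
  - (a * b)                         ∎

halfTerm-≥0-≤0 : ∀ {a b} → 0ℤ ≤ℤ a → b ≤ℤ 0ℤ → halfTerm a b ≡ 0ℤ
halfTerm-≥0-≤0 {a} {b} a≥0 b≤0 = begin
  halfTerm a b                ≡⟨ halfTerm-abs a b (ℤ.0≤i⇒+∣i∣≡i a≥0) (+∣i∣≡-i b≤0) ⟩
  (a * b + a * (- b)) /ℕ 2    ≡⟨ cong (_/ℕ 2) (cancel a b) ⟩
  0ℤ                          ∎
  where
  cancel : ∀ a b → a * b + a * (- b) ≡ 0ℤ
  cancel = solve-∀

halfTerm-comm : ∀ a b → halfTerm a b ≡ halfTerm b a
halfTerm-comm a b = cong (_/ℕ 2) (begin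
  + ℤ.∣ a ∣ * b + a * + ℤ.∣ b ∣   ≡⟨ ℤ.+-comm (+ ℤ.∣ a ∣ * b) (a * + ℤ.∣ b ∣) ⟩
  a * + ℤ.∣ b ∣ + + ℤ.∣ a ∣ * b   ≡⟨ cong₂ _+_ (ℤ.*-comm a (+ ℤ.∣ b ∣)) (ℤ.*-comm (+ ℤ.∣ a ∣) b) ⟩
  + ℤ.∣ b ∣ * a + b * + ℤ.∣ a ∣   ∎)

halfTerm-≤0-≥0 : ∀ {a b} → a ≤ℤ 0ℤ → 0ℤ ≤ℤ b → halfTerm a b ≡ 0ℤ
halfTerm-≤0-≥0 {a} {b} a≤0 b≥0 = trans (halfTerm-comm a b) (halfTerm-≥0-≤0 b≥0 a≤0)

halfTerm-neg : ∀ a b → halfTerm (- a) (- b) ≡ - halfTerm a b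
halfTerm-neg a b with ℤ.≤-total 0ℤ a | ℤ.≤-total 0ℤ b
... | inj₁ a≥0 | inj₁ b≥0 = begin
  halfTerm (- a) (- b)   ≡⟨ halfTerm-≤0-≤0 (ℤ.neg-mono-≤ a≥0) (ℤ.neg-mono-≤ b≥0) ⟩
  - ((- a) * (- b))      ≡⟨ cong -_ (negneg a b) ⟩
  - (a * b)              ≡⟨ cong -_ (halfTerm-≥0-≥0 a≥0 b≥0) ⟨
  - halfTerm a b         ∎
  where
  negneg : ∀ a b → (- a) * (- b) ≡ a * b
  negneg = solve-∀
... | inj₁ a≥0 | inj₂ b≤0 = trans (halfTerm-≤0-≥0 (ℤ.neg-mono-≤ a≥0) (ℤ.neg-mono-≤ b≤0))
  (cong -_ (sym (halfTerm-≥0-≤0 a≥0 b≤0)))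
... | inj₂ a≤0 | inj₁ b≥0 = trans (halfTerm-≥0-≤0 (ℤ.neg-mono-≤ a≤0) (ℤ.neg-mono-≤ b≥0))
  (cong -_ (sym (halfTerm-≤0-≥0 a≤0 b≥0)))
... | inj₂ a≤0 | inj₂ b≤0 = begin
  halfTerm (- a) (- b)   ≡⟨ halfTerm-≥0-≥0 (ℤ.neg-mono-≤ a≤0) (ℤ.neg-mono-≤ b≤0) ⟩
  (- a) * (- b)          ≡⟨ negneg a b ⟩
  - - (a * b)            ≡⟨ cong -_ (halfTerm-≤0-≤0 a≤0 b≤0) ⟨
  - halfTerm a b         ∎
  where
  negneg : ∀ a b → (- a) * (- b) ≡ - - (a * b)
  negneg = solve-∀

halfTerm-negʳ : ∀ a → halfTerm a (- a) ≡ 0ℤ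
halfTerm-negʳ a with ℤ.≤-total 0ℤ a
... | inj₁ a≥0 = halfTerm-≥0-≤0 a≥0 (ℤ.neg-mono-≤ a≥0)
... | inj₂ a≤0 = halfTerm-≤0-≥0 a≤0 (ℤ.neg-mono-≤ a≤0)

halfTerm-negˡ : ∀ a → halfTerm (- a) a ≡ 0ℤ
halfTerm-negˡ a = trans (halfTerm-comm (- a) a) (halfTerm-negʳ a)

halfTerm-neg-swap : ∀ x y → halfTerm (- y) x ≡ - halfTerm (- x) y
halfTerm-neg-swap x y = begin
  halfTerm (- y) x          ≡⟨ halfTerm-comm (- y) x ⟩
  halfTerm x (- y)          ≡⟨ cong (λ z → halfTerm z (- y)) (ℤ.neg-involutive x) ⟨
  halfTerm (- - x) (- y)    ≡⟨ halfTerm-neg (- x) y ⟩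
  - halfTerm (- x) y        ∎

Mat : ℕ → Set
Mat n = Fin n → Fin n → ℤ

infix 4 _≐_

_≐_ : ∀ {n} → Mat n → Mat n → Set
M ≐ M' = ∀ i j → M i j ≡ M' i j

≐-refl : ∀ {n} {M : Mat n} → M ≐ M
≐-refl i j = refl

≐-sym : ∀ {n} {M M' : Mat n} → M ≐ M' → M' ≐ M
≐-sym M≐M' i j = sym (M≐M' i j)

≐-trans : ∀ {n} {M M' M'' : Mat n} → M ≐ M' → M' ≐ M'' → M ≐ M''
≐-trans M≐M' M'≐M'' i j = trans (M≐M' i j) (M'≐M'' i j)

Skew : ∀ {n} → Mat n → Set
Skew M = ∀ i j → M j i ≡ - M i j

Skew⇒diag≡0 : ∀ {n} {M : Mat n} → Skew M → ∀ i → M i i ≡ 0ℤ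
Skew⇒diag≡0 skew i = i≡-i⇒i≡0 (skew i i)

Skew-≐ : ∀ {n} {M M' : Mat n} → Skew M → Skew M' →
  (∀ i j → toℕ i ℕ.< toℕ j → M i j ≡ M' i j) → M ≐ M'
Skew-≐ {M = M} {M'} skew skew' upper i j with ℕ.<-cmp (toℕ i) (toℕ j)
... | tri< i<j _ _ = upper i j i<j
... | tri≈ _ i≡j _ rewrite Fin.toℕ-injective i≡j =
  trans (Skew⇒diag≡0 skew j) (sym (Skew⇒diag≡0 skew' j))
... | tri> _ _ j<i = begin
  M i j       ≡⟨ skew j i ⟩
  - M j i     ≡⟨ cong -_ (upper j i j<i) ⟩
  - M' j i    ≡⟨ skew' j i ⟨
  M' i j      ∎

touches : ∀ {n} → Fin n → Fin n → Fin n → Bool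
touches k i j = ⌊ k Fin.≟ i ⌋ ∨ ⌊ k Fin.≟ j ⌋

μᴹ : ∀ {n} → Fin n → Mat n → Mat n
μᴹ k M i j = if touches k i j then - M i j else M i j + halfTerm (M i k) (M k j)

μᴹs : ∀ {n} → List (Fin n) → Mat n → Mat n
μᴹs [] M = M
μᴹs (k ∷ ks) M = μᴹs ks (μᴹ k M)

μᴹ-cong : ∀ {n} (k : Fin n) {M M' : Mat n} → M ≐ M' → μᴹ k M ≐ μᴹ k M'
μᴹ-cong k M≐M' i j rewrite M≐M' i j | M≐M' i k | M≐M' k j = refl

μᴹs-cong : ∀ {n} (ks : List (Fin n)) {M M' : Mat n} → M ≐ M' → μᴹs ks M ≐ μᴹs ks M'
μᴹs-cong [] M≐M' = M≐M'
μᴹs-cong (k ∷ ks) M≐M' = μᴹs-cong ks (μᴹ-cong k M≐M')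

μᴹ-skew : ∀ {n} (k : Fin n) {M : Mat n} → Skew M → Skew (μᴹ k M)
μᴹ-skew k {M} skew i j rewrite Bool.∨-comm ⌊ k Fin.≟ j ⌋ ⌊ k Fin.≟ i ⌋ with touches k i j
... | true = cong -_ (skew i j)
... | false = begin
  M j i + halfTerm (M j k) (M k i)              ≡⟨ cong₂ (λ x y → M j i + halfTerm x y) (skew k j) (skew i k) ⟩
  M j i + halfTerm (- M k j) (- M i k)          ≡⟨ cong₂ _+_ (skew i j) (halfTerm-neg (M k j) (M i k)) ⟩
  - M i j + - halfTerm (M k j) (M i k)          ≡⟨ cong (λ x → - M i j + - x) (halfTerm-comm (M k j) (M i k)) ⟩
  - M i j + - halfTerm (M i k) (M k j)          ≡⟨ ℤ.neg-distrib-+ (M i j) _ ⟨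
  - (M i j + halfTerm (M i k) (M k j))          ∎

⌊k≟k⌋ : ∀ {n} (k : Fin n) → ⌊ k Fin.≟ k ⌋ ≡ true
⌊k≟k⌋ k with k Fin.≟ k
... | yes _ = refl
... | no k≢k = ⊥-elim (k≢k refl)

μᴹ-involutive : ∀ {n} (k : Fin n) (M : Mat n) → μᴹ k (μᴹ k M) ≐ M
μᴹ-involutive k M i j with touches k i j
... | true = ℤ.neg-involutive (M i j)
... | false = begin
  M i j + h + halfTerm (μᴹ k M i k) (μᴹ k M k j)  ≡⟨ cong₂ (λ x y → M i j + h + halfTerm x y) col row ⟩
  M i j + h + halfTerm (- M i k) (- M k j)          ≡⟨ cong (λ x → M i j + h + x) (halfTerm-neg (M i k) (M k j)) ⟩
  M i j + h + - h                                   ≡⟨ cancel (M i j) h ⟩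
  M i j                                             ∎
  where
  h : ℤ
  h = halfTerm (M i k) (M k j)
  col : μᴹ k M i k ≡ - M i k
  col rewrite ⌊k≟k⌋ k | Bool.∨-zeroʳ ⌊ k Fin.≟ i ⌋ = refl
  row : μᴹ k M k j ≡ - M k j
  row rewrite ⌊k≟k⌋ k = refl
  cancel : ∀ x h → x + h + - h ≡ x
  cancel = solve-∀

coord-irrelevant : ∀ {n} (Q : Quiv n) {i j : Fin n} (p q : toℕ i ℕ.< toℕ j) → Q ((i , j) , p) ≡ Q ((i , j) , q)
coord-irrelevant Q p q = cong (λ r → Q (_ , r)) (ℕ.<-irrelevant p q)

bm-< : ∀ {n} (Q : Quiv n) {i j : Fin n} (i<j : toℕ i ℕ.< toℕ j) → bm Q i j ≡ Q ((i , j) , i<j)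
bm-< Q {i} {j} i<j with ℕ.<-cmp (toℕ i) (toℕ j)
... | tri< i<j' _ _ = cong (λ p → Q (_ , p)) (ℕ.<-irrelevant i<j' i<j)
... | tri≈ i≮j _ _ = ⊥-elim (i≮j i<j)
... | tri> i≮j _ _ = ⊥-elim (i≮j i<j)

bm-≥2 : ∀ {n} {Q : Quiv n} → (∀ c → + 2 ≤ℤ Q c) → ∀ {i j} → toℕ i ℕ.< toℕ j → + 2 ≤ℤ bm Q i j
bm-≥2 {Q = Q} Q≥2 i<j = subst (+ 2 ≤ℤ_) (sym (bm-< Q i<j)) (Q≥2 _)

bm-skew : ∀ {n} (Q : Quiv n) → Skew (bm Q)
bm-skew Q i j with ℕ.<-cmp (toℕ i) (toℕ j) | ℕ.<-cmp (toℕ j) (toℕ i)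
... | tri< i<j _ _ | tri> _ _ i<j' = cong (λ p → - Q (_ , p)) (ℕ.<-irrelevant i<j' i<j)
... | tri≈ _ _ _   | tri≈ _ _ _   = refl
... | tri> _ _ j<i | tri< j<i' _ _ = begin
  Q (_ , j<i')       ≡⟨ cong (λ p → Q (_ , p)) (ℕ.<-irrelevant j<i' j<i) ⟩
  Q (_ , j<i)        ≡⟨ ℤ.neg-involutive _ ⟨
  - - Q (_ , j<i)    ∎
... | tri< i<j _ _ | tri< j<i _ _ = ⊥-elim (ℕ.<-asym i<j j<i)
... | tri< _ i≢j _ | tri≈ _ j≡i _ = ⊥-elim (i≢j (sym j≡i))
... | tri≈ _ i≡j _ | tri< _ j≢i _ = ⊥-elim (j≢i (sym i≡j))
... | tri≈ _ i≡j _ | tri> _ j≢i _ = ⊥-elim (j≢i (sym i≡j))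
... | tri> _ i≢j _ | tri≈ _ j≡i _ = ⊥-elim (i≢j (sym j≡i))
... | tri> _ _ j<i | tri> _ _ i<j = ⊥-elim (ℕ.<-asym i<j j<i)

bm-cong : ∀ {n} {Q Q' : Quiv n} → Q ≈Q Q' → bm Q ≐ bm Q'
bm-cong {Q = Q} {Q'} Q≈Q' = Skew-≐ (bm-skew Q) (bm-skew Q') λ i j i<j →
  trans (bm-< Q i<j) (trans (Q≈Q' _) (sym (bm-< Q' i<j)))

bm-μ : ∀ {n} (k : Fin n) (Q : Quiv n) → bm (μ k Q) ≐ μᴹ k (bm Q)
bm-μ k Q = Skew-≐ (bm-skew (μ k Q)) (μᴹ-skew k (bm-skew Q)) λ i j i<j →
  trans (bm-< (μ k Q) i<j)
    (cong (λ x → if touches k i j then - x else x + halfTerm (bm Q i k) (bm Q k j)) (sym (bm-< Q i<j)))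

bm-μs : ∀ {n} (ks : List (Fin n)) (Q : Quiv n) → bm (μs ks Q) ≐ μᴹs ks (bm Q)
bm-μs [] Q = ≐-refl
bm-μs (k ∷ ks) Q = ≐-trans (bm-μs ks (μ k Q)) (μᴹs-cong ks (bm-μ k Q))

bm-restrict : ∀ {n} (Q : Quiv (suc n)) → bm (restrict Q) ≐ (λ i j → bm Q (inject₁ i) (inject₁ j))
bm-restrict Q = Skew-≐ (bm-skew (restrict Q)) (λ i j → bm-skew Q (inject₁ i) (inject₁ j)) λ i j i<j →
  trans (bm-< (restrict Q) i<j) (sym (bm-< Q _))

bm-lastCol : ∀ {n} (Q : Quiv (suc n)) i → bm Q (inject₁ i) (fromℕ n) ≡ lastCol Q i
bm-lastCol Q i = bm-< Q _

NonIsolatedAlong : ∀ {n} → Mat n → List (Fin n) → Set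
NonIsolatedAlong M [] = ⊤
NonIsolatedAlong M (k ∷ ks) = (∃[ j ] M j k ≢ 0ℤ) × NonIsolatedAlong (μᴹ k M) ks

infix 4 _─[_]→_

_─[_]→_ : ∀ {n} → Mat n → List (Fin n) → Mat n → Set
M ─[ ks ]→ M' = NonIsolatedAlong M ks × μᴹs ks M ≐ M'

NonIsolatedAlong-cong : ∀ {n} (ks : List (Fin n)) {M M' : Mat n} → M ≐ M' →
  NonIsolatedAlong M ks → NonIsolatedAlong M' ks
NonIsolatedAlong-cong [] M≐M' _ = tt
NonIsolatedAlong-cong (k ∷ ks) M≐M' ((j , Mjk≢0) , rest) =
  (j , λ M'jk≡0 → Mjk≢0 (trans (M≐M' j k) M'jk≡0)) , NonIsolatedAlong-cong ks (μᴹ-cong k M≐M') rest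

─[]→-refl : ∀ {n} {M M' : Mat n} → M ≐ M' → M ─[ [] ]→ M'
─[]→-refl M≐M' = tt , M≐M'

─[]→-single : ∀ {n} {M M' : Mat n} k j → M j k ≢ 0ℤ → μᴹ k M ≐ M' → M ─[ [ k ] ]→ M'
─[]→-single k j Mjk≢0 μM≐M' = ((j , Mjk≢0) , tt) , μM≐M'

─[]→-trans : ∀ {n} {M M' M'' : Mat n} (ks ks' : List (Fin n)) →
  M ─[ ks ]→ M' → M' ─[ ks' ]→ M'' → M ─[ ks ++ ks' ]→ M''
─[]→-trans [] ks' (_ , M≐M') (noIso' , run') =
  NonIsolatedAlong-cong ks' (≐-sym M≐M') noIso' , ≐-trans (μᴹs-cong ks' M≐M') run'
─[]→-trans (k ∷ ks) ks' (((j , nz) , noIso) , run) r' =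
  let noIso″ , run″ = ─[]→-trans ks ks' (noIso , run) r' in ((j , nz) , noIso″) , run″

─[]→-congˡ : ∀ {n} {M M' M'' : Mat n} (ks : List (Fin n)) → M ≐ M' → M ─[ ks ]→ M'' → M' ─[ ks ]→ M''
─[]→-congˡ ks M≐M' (noIso , run) =
  NonIsolatedAlong-cong ks M≐M' noIso , ≐-trans (μᴹs-cong ks (≐-sym M≐M')) run

─[]→-congʳ : ∀ {n} {M M' M'' : Mat n} (ks : List (Fin n)) → M' ≐ M'' → M ─[ ks ]→ M' → M ─[ ks ]→ M''
─[]→-congʳ ks M'≐M'' (noIso , run) = noIso , ≐-trans run M'≐M''

NonIsolatedAlong⇒NoIsolatedMut : ∀ {n} (ks : List (Fin n)) (Q : Quiv n) → NonIsolatedAlong (bm Q) ks → NoIsolatedMut Q ks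
NonIsolatedAlong⇒NoIsolatedMut [] Q _ = tt
NonIsolatedAlong⇒NoIsolatedMut (k ∷ ks) Q ((j , bm≢0) , rest) =
  (λ isolated → bm≢0 (isolated j)) ,
  NonIsolatedAlong⇒NoIsolatedMut ks (μ k Q) (NonIsolatedAlong-cong ks (≐-sym (bm-μ k Q)) rest)

─[]→⇒IsMutationCycle : ∀ {n} {ks : List (Fin n)} (Q : Quiv n) → CycDistinct ks → bm Q ─[ ks ]→ bm Q →
  IsMutationCycle ks Q
─[]→⇒IsMutationCycle {ks = ks} Q distinct (nonIsolated , returns) =
  distinct , NonIsolatedAlong⇒NoIsolatedMut ks Q nonIsolated , λ where
    ((i , j) , i<j) → begin
      μs ks Q ((i , j) , i<j)    ≡⟨ bm-< (μs ks Q) i<j ⟨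
      bm (μs ks Q) i j           ≡⟨ bm-μs ks Q i j ⟩
      μᴹs ks (bm Q) i j          ≡⟨ returns i j ⟩
      bm Q i j                   ≡⟨ bm-< Q i<j ⟩
      Q ((i , j) , i<j)          ∎

-- Rounds: mutation at 2, then at 1

pattern v₁ = fz
pattern v₂ = fs fz
pattern other r = fs (fs r)

bordered : ∀ {n} → ℤ → (Fin n → ℤ × ℤ) → Mat n → Mat (suc (suc n))
bordered a p e v₁ v₁ = 0ℤ
bordered a p e v₁ v₂ = a
bordered a p e v₁ (other s) = proj₁ (p s)
bordered a p e v₂ v₁ = - a
bordered a p e v₂ v₂ = 0ℤ
bordered a p e v₂ (other s) = proj₂ (p s)
bordered a p e (other r) v₁ = - proj₁ (p r)
bordered a p e (other r) v₂ = - proj₂ (p r)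
bordered a p e (other r) (other s) = e r s

bordered-cong : ∀ {n} {a a' : ℤ} {p p' : Fin n → ℤ × ℤ} {e e' : Mat n} →
  a ≡ a' → (∀ r → p r ≡ p' r) → e ≐ e' → bordered a p e ≐ bordered a' p' e'
bordered-cong a≡a' p≗p' e≐e' v₁ v₁ = refl
bordered-cong a≡a' p≗p' e≐e' v₁ v₂ = a≡a'
bordered-cong a≡a' p≗p' e≐e' v₁ (other s) = cong proj₁ (p≗p' s)
bordered-cong a≡a' p≗p' e≐e' v₂ v₁ = cong -_ a≡a'
bordered-cong a≡a' p≗p' e≐e' v₂ v₂ = refl
bordered-cong a≡a' p≗p' e≐e' v₂ (other s) = cong proj₂ (p≗p' s)
bordered-cong a≡a' p≗p' e≐e' (other r) v₁ = cong (λ v → - proj₁ v) (p≗p' r)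
bordered-cong a≡a' p≗p' e≐e' (other r) v₂ = cong (λ v → - proj₂ v) (p≗p' r)
bordered-cong a≡a' p≗p' e≐e' (other r) (other s) = e≐e' r s

bordered-skew : ∀ {n} a p {e : Mat n} → Skew e → Skew (bordered a p e)
bordered-skew a p skew v₁ v₁ = refl
bordered-skew a p skew v₁ v₂ = refl
bordered-skew a p skew v₁ (other s) = refl
bordered-skew a p skew v₂ v₁ = sym (ℤ.neg-involutive a)
bordered-skew a p skew v₂ v₂ = refl
bordered-skew a p skew v₂ (other s) = refl
bordered-skew a p skew (other r) v₁ = sym (ℤ.neg-involutive _)
bordered-skew a p skew (other r) v₂ = sym (ℤ.neg-involutive _)
bordered-skew a p skew (other r) (other s) = skew r s

Skew⇒bordered : ∀ {n} {M : Mat (suc (suc n))} → Skew M →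
  M ≐ bordered (M v₁ v₂) (λ r → M v₁ (other r) , M v₂ (other r)) (λ r s → M (other r) (other s))
Skew⇒bordered skew v₁ v₁ = Skew⇒diag≡0 skew v₁
Skew⇒bordered skew v₁ v₂ = refl
Skew⇒bordered skew v₁ (other s) = refl
Skew⇒bordered skew v₂ v₁ = skew v₁ v₂
Skew⇒bordered skew v₂ v₂ = Skew⇒diag≡0 skew v₂
Skew⇒bordered skew v₂ (other s) = refl
Skew⇒bordered skew (other r) v₁ = skew v₁ (other r)
Skew⇒bordered skew (other r) v₂ = skew v₂ (other r)
Skew⇒bordered skew (other r) (other s) = refl

μ₁-pair : ℤ → ℤ × ℤ → ℤ × ℤ
μ₁-pair a (c , d) = (- c , d + halfTerm (- a) c)

μ₂-pair : ℤ → ℤ × ℤ → ℤ × ℤ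
μ₂-pair a (c , d) = (c + halfTerm a d , - d)

μᴹ-v₁-bordered : ∀ {n} a p (e : Mat n) → μᴹ v₁ (bordered a p e) ≐
  bordered (- a) (λ r → μ₁-pair a (p r)) (λ r s → e r s + halfTerm (- proj₁ (p r)) (proj₁ (p s)))
μᴹ-v₁-bordered a p e v₁ v₁ = refl
μᴹ-v₁-bordered a p e v₁ v₂ = refl
μᴹ-v₁-bordered a p e v₁ (other s) = refl
μᴹ-v₁-bordered a p e v₂ v₁ = refl
μᴹ-v₁-bordered a p e v₂ v₂ = trans (ℤ.+-identityˡ _) (halfTerm-negˡ a)
μᴹ-v₁-bordered a p e v₂ (other s) = refl
μᴹ-v₁-bordered a p e (other r) v₁ = refl
μᴹ-v₁-bordered a p e (other r) v₂ =
  trans (cong (λ x → - d + x) (halfTerm-neg-swap a (proj₁ (p r)))) (sym (ℤ.neg-distrib-+ d _))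
  where
  d : ℤ
  d = proj₂ (p r)
μᴹ-v₁-bordered a p e (other r) (other s) = refl

μᴹ-v₂-bordered : ∀ {n} a p (e : Mat n) → μᴹ v₂ (bordered a p e) ≐
  bordered (- a) (λ r → μ₂-pair a (p r)) (λ r s → e r s + halfTerm (- proj₂ (p r)) (proj₂ (p s)))
μᴹ-v₂-bordered a p e v₁ v₁ = trans (ℤ.+-identityˡ _) (halfTerm-negʳ a)
μᴹ-v₂-bordered a p e v₁ v₂ = refl
μᴹ-v₂-bordered a p e v₁ (other s) = refl
μᴹ-v₂-bordered a p e v₂ v₁ = refl
μᴹ-v₂-bordered a p e v₂ v₂ = refl
μᴹ-v₂-bordered a p e v₂ (other s) = refl
μᴹ-v₂-bordered a p e (other r) v₁ = begin
  - c + halfTerm (- d) (- a)          ≡⟨ cong (λ x → - c + x) (halfTerm-neg d a) ⟩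
  - c + - halfTerm d a                ≡⟨ cong (λ x → - c + - x) (halfTerm-comm d a) ⟩
  - c + - halfTerm a d                ≡⟨ ℤ.neg-distrib-+ c _ ⟨
  - (c + halfTerm a d)                ∎
  where
  c d : ℤ
  c = proj₁ (p r)
  d = proj₂ (p r)
μᴹ-v₂-bordered a p e (other r) v₂ = refl
μᴹ-v₂-bordered a p e (other r) (other s) = refl

roundPair : ℤ → ℤ × ℤ → ℤ × ℤ
roundPair a v = (- u , - proj₂ v + halfTerm a u)
  where
  u : ℤ
  u = proj₁ (μ₂-pair a v)

roundCorrection : ℤ → ℤ × ℤ → ℤ × ℤ → ℤ
roundCorrection a v w = halfTerm (- proj₂ v) (proj₂ w) + halfTerm (- u v) (u w)
  where
  u : ℤ × ℤ → ℤ
  u v = proj₁ (μ₂-pair a v)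

roundBlock : ∀ {n} → ℤ → (Fin n → ℤ × ℤ) → Mat n → Mat n
roundBlock a p e r s = e r s + roundCorrection a (p r) (p s)

round : ∀ {n} a p (e : Mat n) → a ≢ 0ℤ →
  bordered a p e ─[ v₂ ∷ v₁ ∷ [] ]→ bordered a (λ r → roundPair a (p r)) (roundBlock a p e)
round {n} a p e a≢0 = ((v₁ , a≢0) , (v₂ , -a≢0) , tt) ,
  ≐-trans (μᴹ-cong v₁ (μᴹ-v₂-bordered a p e))
  (≐-trans (μᴹ-v₁-bordered (- a) _ _)
  (bordered-cong (ℤ.neg-involutive a) (λ r → cong (λ x → (- u r , - proj₂ (p r) + halfTerm x (u r))) (ℤ.neg-involutive a))
    (λ r s → ℤ.+-assoc (e r s) _ _)))
  where
  u : Fin n → ℤ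
  u r = proj₁ (μ₂-pair a (p r))
  -a≢0 : μᴹ v₂ (bordered a p e) v₂ v₁ ≢ 0ℤ
  -a≢0 a′≡0 = a≢0 (trans (sym (ℤ.neg-involutive a)) a′≡0)

round⁻¹ : ∀ {n} {a} {p p'} {e e' : Mat n} → a ≢ 0ℤ →
  μᴹs (v₂ ∷ v₁ ∷ []) (bordered a p e) ≐ bordered a p' e' → bordered a p' e' ─[ v₁ ∷ v₂ ∷ [] ]→ bordered a p e
round⁻¹ {a = a} {p} {p'} {e} {e'} a≢0 roundEq =
  ((v₂ , -a≢0) , (v₁ , -a≢0) , tt) ,
  ≐-trans (μᴹ-cong v₂ (μᴹ-cong v₁ (≐-sym roundEq)))
  (≐-trans (μᴹ-cong v₂ (μᴹ-involutive v₁ (μᴹ v₂ (bordered a p e)))) (μᴹ-involutive v₂ (bordered a p e)))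
  where
  -a≢0 : - a ≢ 0ℤ
  -a≢0 -a≡0 = a≢0 (trans (sym (ℤ.neg-involutive a)) (cong -_ -a≡0))

roundCorrection-antisym : ∀ a v w → roundCorrection a w v ≡ - roundCorrection a v w
roundCorrection-antisym a (c , d) (c' , d') =
  trans (cong₂ _+_ (halfTerm-neg-swap d d') (halfTerm-neg-swap u u'))
        (sym (ℤ.neg-distrib-+ (halfTerm (- d) d') (halfTerm (- u) u')))
  where
  u u' : ℤ
  u = proj₁ (μ₂-pair a (c , d))
  u' = proj₁ (μ₂-pair a (c' , d'))

roundCorrection-self : ∀ a v → roundCorrection a v v ≡ 0ℤ
roundCorrection-self a (c , d) = cong₂ _+_ (halfTerm-negˡ d) (halfTerm-negˡ (proj₁ (μ₂-pair a (c , d))))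

T : ℤ → ℤ × ℤ → ℤ × ℤ
T a (c , d) = (- (c + a * d) , - d + a * (c + a * d))

T⁻¹ : ℤ → ℤ × ℤ → ℤ × ℤ
T⁻¹ a (c , d) = ((a * a + - + 1) * c + a * d , - d + - (a * c))

T⁻¹∘T : ∀ a v → T⁻¹ a (T a v) ≡ v
T⁻¹∘T a (c , d) = cong₂ _,_ (first a c d) (second a c d)
  where
  first : ∀ a c d → (a * a + - + 1) * (- (c + a * d)) + a * (- d + a * (c + a * d)) ≡ c
  first = solve-∀
  second : ∀ a c d → - (- d + a * (c + a * d)) + - (a * (- (c + a * d))) ≡ d
  second = solve-∀

T∘T⁻¹ : ∀ a v → T a (T⁻¹ a v) ≡ v
T∘T⁻¹ a (c , d) = cong₂ _,_ (first a c d) (second a c d)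
  where
  first : ∀ a c d → - ((a * a + - + 1) * c + a * d + a * (- d + - (a * c))) ≡ c
  first = solve-∀
  second : ∀ a c d →
    - (- d + - (a * c)) + a * ((a * a + - + 1) * c + a * d + a * (- d + - (a * c))) ≡ d
  second = solve-∀

negSwap : ℤ × ℤ → ℤ × ℤ
negSwap (c , d) = (- d , - c)

T-negSwap-T : ∀ a v → T a (negSwap (T a v)) ≡ negSwap v
T-negSwap-T a (c , d) = cong₂ _,_ (first a c d) (second a c d)
  where
  first : ∀ a c d → - (- (- d + a * (c + a * d)) + a * (- - (c + a * d))) ≡ - d
  first = solve-∀
  second : ∀ a c d →
    - (- - (c + a * d)) + a * (- (- d + a * (c + a * d)) + a * (- - (c + a * d))) ≡ - c
  second = solve-∀

-- The sign patterns of a column (b₁ᵣ, b₂ᵣ) on which a round acts linearly: by T a, resp. by negation.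
Forward : ℤ → ℤ × ℤ → Set
Forward a (c , d) = 0ℤ ≤ℤ d × 0ℤ ≤ℤ c + a * d

Backward : ℤ × ℤ → Set
Backward (c , d) = c ≤ℤ 0ℤ × d ≤ℤ 0ℤ

-- The column of vertex n changes by ± this T-adjoint form in the two rounds in which some columns are Backward.
form : ℤ → ℤ × ℤ → ℤ × ℤ → ℤ
form a (c , d) (c' , d') = c * d' + d * c' + a * d * d'

form-T : ∀ a v w → form a (T a v) w ≡ form a v (T a w)
form-T a (c , d) (c' , d') = identity a c d c' d'
  where
  identity : ∀ a c d c' d' →
    - (c + a * d) * d' + (- d + a * (c + a * d)) * c' + a * (- d + a * (c + a * d)) * d'
      ≡ c * (- d' + a * (c' + a * d')) + d * (- (c' + a * d')) + a * d * (- d' + a * (c' + a * d'))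
  identity = solve-∀

cross : ℤ → ℤ × ℤ → ℤ × ℤ → ℤ
cross a (c , d) (c' , d') = d * d' + (c + a * d) * c'

cross-negSwap : ∀ a u w → cross a u (negSwap w) ≡ - form a u w
cross-negSwap a (c , d) (c' , d') = identity a c d c' d'
  where
  identity : ∀ a c d c' d' → d * (- c') + (c + a * d) * (- d') ≡ - (c * d' + d * c' + a * d * d')
  identity = solve-∀

cross-negSwap-T : ∀ a w v → cross a (negSwap (T a w)) (- proj₁ v , - proj₂ v) ≡ - form a v w
cross-negSwap-T a (c' , d') (c , d) = identity a c d c' d'
  where
  identity : ∀ a c d c' d' →
    - - (c' + a * d') * (- d) + (- (- d' + a * (c' + a * d')) + a * (- - (c' + a * d'))) * (- c)
      ≡ - (c * d' + d * c' + a * d * d')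
  identity = solve-∀

module _ {a : ℤ} (a≥0 : 0ℤ ≤ℤ a) where

  μ₂-pair-Forward : ∀ v → Forward a v → proj₁ (μ₂-pair a v) ≡ proj₁ v + a * proj₂ v
  μ₂-pair-Forward (c , d) (d≥0 , _) = cong (λ x → c + x) (halfTerm-≥0-≥0 a≥0 d≥0)

  μ₂-pair-Backward : ∀ v → Backward v → proj₁ (μ₂-pair a v) ≡ proj₁ v
  μ₂-pair-Backward (c , d) (_ , d≤0) = trans (cong (λ x → c + x) (halfTerm-≥0-≤0 a≥0 d≤0)) (ℤ.+-identityʳ c)

  roundPair-via : ∀ v {u} → proj₁ (μ₂-pair a v) ≡ u → roundPair a v ≡ (- u , - proj₂ v + halfTerm a u)
  roundPair-via (c , d) = cong (λ u → (- u , - d + halfTerm a u))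

  roundCorrection-via : ∀ v w {u u'} → proj₁ (μ₂-pair a v) ≡ u → proj₁ (μ₂-pair a w) ≡ u' →
    roundCorrection a v w ≡ halfTerm (- proj₂ v) (proj₂ w) + halfTerm (- u) u'
  roundCorrection-via (c , d) (c' , d') = cong₂ (λ u u' → halfTerm (- d) d' + halfTerm (- u) u')

  roundPair-Forward : ∀ v → Forward a v → roundPair a v ≡ T a v
  roundPair-Forward (c , d) fwd@(_ , u≥0) = trans (roundPair-via (c , d) (μ₂-pair-Forward (c , d) fwd))
    (cong (λ x → (- (c + a * d) , - d + x)) (halfTerm-≥0-≥0 a≥0 u≥0))

  roundPair-Backward : ∀ v → Backward v → roundPair a v ≡ (- proj₁ v , - proj₂ v)
  roundPair-Backward (c , d) bwd@(c≤0 , _) = trans (roundPair-via (c , d) (μ₂-pair-Backward (c , d) bwd))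
    (cong (λ x → (- c , x)) (trans (cong (λ x → - d + x) (halfTerm-≥0-≤0 a≥0 c≤0)) (ℤ.+-identityʳ (- d))))

  roundCorrection-FF : ∀ v w → Forward a v → Forward a w → roundCorrection a v w ≡ 0ℤ
  roundCorrection-FF (c , d) (c' , d') fv@(d≥0 , u≥0) fw@(d'≥0 , u'≥0) =
    trans (roundCorrection-via (c , d) (c' , d') (μ₂-pair-Forward (c , d) fv) (μ₂-pair-Forward (c' , d') fw))
    (cong₂ _+_ (halfTerm-≤0-≥0 (ℤ.neg-mono-≤ d≥0) d'≥0) (halfTerm-≤0-≥0 (ℤ.neg-mono-≤ u≥0) u'≥0))

  roundCorrection-BB : ∀ v w → Backward v → Backward w → roundCorrection a v w ≡ 0ℤ
  roundCorrection-BB (c , d) (c' , d') bv@(c≤0 , d≤0) bw@(c'≤0 , d'≤0) =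
    trans (roundCorrection-via (c , d) (c' , d') (μ₂-pair-Backward (c , d) bv) (μ₂-pair-Backward (c' , d') bw))
    (cong₂ _+_ (halfTerm-≥0-≤0 (ℤ.neg-mono-≤ d≤0) d'≤0) (halfTerm-≥0-≤0 (ℤ.neg-mono-≤ c≤0) c'≤0))

  roundCorrection-FB : ∀ v w → Forward a v → Backward w → roundCorrection a v w ≡ cross a v w
  roundCorrection-FB (c , d) (c' , d') fv@(d≥0 , u≥0) bw@(c'≤0 , d'≤0) = begin
    roundCorrection a (c , d) (c' , d')
      ≡⟨ roundCorrection-via (c , d) (c' , d') (μ₂-pair-Forward (c , d) fv) (μ₂-pair-Backward (c' , d') bw) ⟩
    halfTerm (- d) d' + halfTerm (- (c + a * d)) c'         ≡⟨ cong₂ _+_ (halfTerm-≤0-≤0 (ℤ.neg-mono-≤ d≥0) d'≤0)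
                                                                          (halfTerm-≤0-≤0 (ℤ.neg-mono-≤ u≥0) c'≤0) ⟩
    - ((- d) * d') + - ((- (c + a * d)) * c')               ≡⟨ identity c d c' d' a ⟩
    d * d' + (c + a * d) * c'                               ∎
    where
    identity : ∀ c d c' d' a → - ((- d) * d') + - ((- (c + a * d)) * c') ≡ d * d' + (c + a * d) * c'
    identity = solve-∀

  roundCorrection-BF : ∀ v w → Backward v → Forward a w → roundCorrection a v w ≡ - cross a w v
  roundCorrection-BF (c , d) (c' , d') bv@(c≤0 , d≤0) fw@(d'≥0 , u'≥0) = begin
    roundCorrection a (c , d) (c' , d')
      ≡⟨ roundCorrection-via (c , d) (c' , d') (μ₂-pair-Backward (c , d) bv) (μ₂-pair-Forward (c' , d') fw) ⟩
    halfTerm (- d) d' + halfTerm (- c) (c' + a * d')        ≡⟨ cong₂ _+_ (halfTerm-≥0-≥0 (ℤ.neg-mono-≤ d≤0) d'≥0)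
                                                                          (halfTerm-≥0-≥0 (ℤ.neg-mono-≤ c≤0) u'≥0) ⟩
    (- d) * d' + (- c) * (c' + a * d')                      ≡⟨ identity c d c' d' a ⟩
    - (d' * d + (c' + a * d') * c)                          ∎
    where
    identity : ∀ c d c' d' a → (- d) * d' + (- c) * (c' + a * d') ≡ - (d' * d + (c' + a * d') * c)
    identity = solve-∀

round-Forward : ∀ {n} {a} p (e : Mat n) → 0ℤ ≤ℤ a → a ≢ 0ℤ → (∀ r → Forward a (p r)) →
  bordered a p e ─[ v₂ ∷ v₁ ∷ [] ]→ bordered a (λ r → T a (p r)) e
round-Forward {a = a} p e a≥0 a≢0 fwd = ─[]→-congʳ (v₂ ∷ v₁ ∷ [])
  (bordered-cong refl (λ r → roundPair-Forward a≥0 (p r) (fwd r))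
    (λ r s → trans (cong (λ x → e r s + x) (roundCorrection-FF a≥0 (p r) (p s) (fwd r) (fwd s))) (ℤ.+-identityʳ (e r s))))
  (round a p e a≢0)

Growing : ℤ → ℤ × ℤ → Set
Growing a (c , d) = + 1 ≤ℤ d × d ≤ℤ c + a * d

private
  y≤-x+ay : ∀ {a x y} → + 2 ≤ℤ a → x ≤ℤ y → 0ℤ ≤ℤ y → y ≤ℤ - x + a * y
  y≤-x+ay {a} {x} {y} a≥2 x≤y y≥0 = subst (_≤ℤ - x + a * y) (sym (identity y))
    (ℤ.+-mono-≤ (ℤ.neg-mono-≤ x≤y) (ℤ.*-monoʳ-≤-nonNeg y {{ℤ.nonNegative y≥0}} a≥2))
    where
    identity : ∀ y → y ≡ - y + + 2 * y
    identity = solve-∀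

Growing-T : ∀ {a} → + 2 ≤ℤ a → ∀ v → Growing a v → Growing a (T a v)
Growing-T {a} a≥2 (c , d) (d≥1 , d≤u) = ℤ.≤-trans d≥1 (ℤ.≤-trans d≤u u≤d') , y≤-x+ay a≥2 u≤d' d'≥0
  where
  u≥0 : 0ℤ ≤ℤ c + a * d
  u≥0 = ℤ.≤-trans (ℤ.≤-trans (+≤+ z≤n) d≥1) d≤u
  u≤d' : c + a * d ≤ℤ - d + a * (c + a * d)
  u≤d' = y≤-x+ay a≥2 d≤u u≥0
  d'≥0 : 0ℤ ≤ℤ - d + a * (c + a * d)
  d'≥0 = ℤ.≤-trans u≥0 u≤d'

Growing-fold : ∀ {a} → + 2 ≤ℤ a → ∀ {v} n → Growing a v → Growing a (fold v (T a) n)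
Growing-fold {a} a≥2 = fold-preserves (Growing a) (λ {v} → Growing-T a≥2 v)

Growing-init : ∀ {a c d} → + 2 ≤ℤ a → 0ℤ ≤ℤ c → + 1 ≤ℤ d → Growing a (c , d)
Growing-init {a} {c} {d} a≥2 c≥0 d≥1 = d≥1 , ℤ.≤-trans d≤ad (ℤ.i≤j+i (a * d) c {{ℤ.nonNegative c≥0}})
  where
  d≤ad : d ≤ℤ a * d
  d≤ad = subst (_≤ℤ a * d) (ℤ.*-identityˡ d)
    (ℤ.*-monoʳ-≤-nonNeg d {{ℤ.nonNegative (ℤ.≤-trans (+≤+ z≤n) d≥1)}} (ℤ.≤-trans (+≤+ (s≤s z≤n)) a≥2))

Growing⇒Forward : ∀ a v → Growing a v → Forward a v
Growing⇒Forward a (c , d) (d≥1 , d≤u) = d≥0 , ℤ.≤-trans d≥0 d≤u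
  where
  d≥0 : 0ℤ ≤ℤ d
  d≥0 = ℤ.≤-trans (+≤+ z≤n) d≥1

Growing⇒Forward-negSwap-T : ∀ a v → Growing a v → Forward a (negSwap (T a v))
Growing⇒Forward-negSwap-T a v@(c , d) growing@(_ , d≤u) =
  subst (0ℤ ≤ℤ_) (sym (ℤ.neg-involutive (c + a * d))) u≥0 ,
  subst (0ℤ ≤ℤ_) (sym (identity a c d)) d≥0
  where
  d≥0 : 0ℤ ≤ℤ d
  d≥0 = proj₁ (Growing⇒Forward a v growing)
  u≥0 : 0ℤ ≤ℤ c + a * d
  u≥0 = ℤ.≤-trans d≥0 d≤u
  identity : ∀ a c d → - (- d + a * (c + a * d)) + a * (- - (c + a * d)) ≡ d
  identity = solve-∀

rounds-Growing : ∀ {n} {a} → + 2 ≤ℤ a → ∀ j p (e : Mat n) → (∀ r → Growing a (p r)) →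
  bordered a p e ─[ concat (replicate j (v₂ ∷ v₁ ∷ [])) ]→ bordered a (λ r → fold (p r) (T a) j) e
rounds-Growing a≥2 zero p e growing = ─[]→-refl ≐-refl
rounds-Growing {a = a} a≥2 (suc j) p e growing = ─[]→-trans (v₂ ∷ v₁ ∷ []) (concat (replicate j (v₂ ∷ v₁ ∷ [])))
  (round-Forward p e a≥0 a≢0 (λ r → Growing⇒Forward a (p r) (growing r)))
  (─[]→-congʳ (concat (replicate j (v₂ ∷ v₁ ∷ []))) (bordered-cong refl (λ r → sym (fold-suc′ (T a) (p r) j)) ≐-refl)
    (rounds-Growing a≥2 j (λ r → T a (p r)) e (λ r → Growing-T a≥2 (p r) (growing r))))
  where
  a≥0 : 0ℤ ≤ℤ a
  a≥0 = ℤ.≤-trans (+≤+ z≤n) a≥2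
  a≢0 : a ≢ 0ℤ
  a≢0 = 1≤i⇒i≢0 (ℤ.≤-trans (+≤+ (s≤s z≤n)) a≥2)

rounds-≥2 : ∀ {n} (R : Quiv (suc (suc n))) → (∀ c → + 2 ≤ℤ R c) → ∀ j →
  μᴹs (concat (replicate j (v₂ ∷ v₁ ∷ []))) (bm R) ≐
  bordered (bm R v₁ v₂) (λ x → fold (bm R v₁ (other x) , bm R v₂ (other x)) (T (bm R v₁ v₂)) j)
    (λ x y → bm R (other x) (other y))
rounds-≥2 R R≥2 j = ≐-trans (μᴹs-cong (concat (replicate j (v₂ ∷ v₁ ∷ []))) (Skew⇒bordered (bm-skew R)))
  (proj₂ (rounds-Growing a≥2 j _ _ growing))
  where
  a≥2 : + 2 ≤ℤ bm R v₁ v₂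
  a≥2 = bm-≥2 R≥2 (s≤s z≤n)
  growing : ∀ x → Growing (bm R v₁ v₂) (bm R v₁ (other x) , bm R v₂ (other x))
  growing x = Growing-init a≥2 (2≤i⇒0≤i (bm-≥2 R≥2 (s≤s z≤n))) (2≤i⇒1≤i (bm-≥2 R≥2 (s≤s (s≤s z≤n))))

±[_] : Bool → ℤ → ℤ
±[ b ] x = if b then - x else x

±-neg : ∀ b x → ±[ b ] (- x) ≡ - ±[ b ] x
±-neg true x = refl
±-neg false x = refl

±-± : ∀ b c x → ±[ b ] (±[ c ] x) ≡ ±[ b xor c ] x
±-± true true x = ℤ.neg-involutive x
±-± true false x = refl
±-± false c x = refl

±-comm : ∀ b c x → ±[ b ] (±[ c ] x) ≡ ±[ c ] (±[ b ] x)
±-comm true true x = refl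
±-comm true false x = refl
±-comm false true x = refl
±-comm false false x = refl

flipᴹ : ∀ {n} → (Fin n → Bool) → Mat n → Mat n
flipᴹ σ M i j = ±[ σ i ] (±[ σ j ] (M i j))

flipᴹ-cong : ∀ {n} {σ τ : Fin n → Bool} {M M' : Mat n} → (∀ i → σ i ≡ τ i) → M ≐ M' → flipᴹ σ M ≐ flipᴹ τ M'
flipᴹ-cong σ≗τ M≐M' i j rewrite σ≗τ i | σ≗τ j | M≐M' i j = refl

flipᴹ-flipᴹ : ∀ {n} (σ τ : Fin n → Bool) (M : Mat n) → flipᴹ σ (flipᴹ τ M) ≐ flipᴹ (λ i → σ i xor τ i) M
flipᴹ-flipᴹ σ τ M i j = begin
  ±[ σ i ] (±[ σ j ] (±[ τ i ] (±[ τ j ] x)))    ≡⟨ cong ±[ σ i ] (±-comm (σ j) (τ i) _) ⟩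
  ±[ σ i ] (±[ τ i ] (±[ σ j ] (±[ τ j ] x)))    ≡⟨ ±-± (σ i) (τ i) _ ⟩
  ±[ σ i xor τ i ] (±[ σ j ] (±[ τ j ] x))       ≡⟨ cong ±[ σ i xor τ i ] (±-± (σ j) (τ j) x) ⟩
  ±[ σ i xor τ i ] (±[ σ j xor τ j ] x)          ∎
  where x = M i j

flipᴹ-skew : ∀ {n} σ {M : Mat n} → Skew M → Skew (flipᴹ σ M)
flipᴹ-skew σ {M} skew i j = begin
  ±[ σ j ] (±[ σ i ] (M j i))      ≡⟨ cong (λ x → ±[ σ j ] (±[ σ i ] x)) (skew i j) ⟩
  ±[ σ j ] (±[ σ i ] (- M i j))    ≡⟨ cong ±[ σ j ] (±-neg (σ i) _) ⟩
  ±[ σ j ] (- ±[ σ i ] (M i j))    ≡⟨ ±-neg (σ j) _ ⟩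
  - ±[ σ j ] (±[ σ i ] (M i j))    ≡⟨ cong -_ (±-comm (σ j) (σ i) _) ⟩
  - ±[ σ i ] (±[ σ j ] (M i j))    ∎

flipᴹ-not : ∀ {n} (σ : Fin n → Bool) (M : Mat n) → flipᴹ (λ i → not (σ i)) M ≐ flipᴹ σ M
flipᴹ-not σ M i j with σ i | σ j
... | true | true = sym (ℤ.neg-involutive _)
... | true | false = refl
... | false | true = refl
... | false | false = ℤ.neg-involutive _

indicator : ∀ {n} → Fin n → Fin n → Bool
indicator k i = does (k Fin.≟ i)

μᴹ-sink : ∀ {n} {M : Mat n} k → Skew M → (∀ i → 0ℤ ≤ℤ M i k) → μᴹ k M ≐ flipᴹ (indicator k) M
μᴹ-sink {M = M} k skew col≥0 i j with k Fin.≟ i | k Fin.≟ j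
... | yes refl | yes refl = trans (cong -_ (Skew⇒diag≡0 skew k)) (sym (trans (ℤ.neg-involutive _) (Skew⇒diag≡0 skew k)))
... | yes refl | no _ = refl
... | no _ | yes refl = refl
... | no _ | no _ = trans (cong (λ x → M i j + x) (halfTerm-≥0-≤0 (col≥0 i) Mkj≤0)) (ℤ.+-identityʳ (M i j))
  where
  Mkj≤0 : M k j ≤ℤ 0ℤ
  Mkj≤0 = subst (_≤ℤ 0ℤ) (sym (skew j k)) (ℤ.neg-mono-≤ (col≥0 j))

onOthers : ∀ {n} → (Fin n → Bool) → Fin (suc (suc n)) → Bool
onOthers τ v₁ = false
onOthers τ v₂ = false
onOthers τ (other r) = τ r

±-pair : Bool → ℤ × ℤ → ℤ × ℤ
±-pair b (c , d) = (±[ b ] c , ±[ b ] d)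

flipᴹ-bordered : ∀ {n} (τ : Fin n → Bool) a p e →
  flipᴹ (onOthers τ) (bordered a p e) ≐ bordered a (λ r → ±-pair (τ r) (p r)) (flipᴹ τ e)
flipᴹ-bordered τ a p e v₁ v₁ = refl
flipᴹ-bordered τ a p e v₁ v₂ = refl
flipᴹ-bordered τ a p e v₁ (other s) = refl
flipᴹ-bordered τ a p e v₂ v₁ = refl
flipᴹ-bordered τ a p e v₂ v₂ = refl
flipᴹ-bordered τ a p e v₂ (other s) = refl
flipᴹ-bordered τ a p e (other r) v₁ = ±-neg (τ r) _
flipᴹ-bordered τ a p e (other r) v₂ = ±-neg (τ r) _
flipᴹ-bordered τ a p e (other r) (other s) = refl

data TopView : ∀ {k} → Fin (suc k) → Set where
  top : ∀ {k} → TopView (fromℕ k)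
  low : ∀ {k} (x : Fin k) → TopView (inject₁ x)

topView : ∀ {k} (i : Fin (suc k)) → TopView i
topView {zero} fz = top
topView {suc k} fz = low fz
topView {suc k} (fs i) with topView i
... | top = top
... | low x = low (fs x)

topView-fromℕ : ∀ k → topView (fromℕ k) ≡ top
topView-fromℕ zero = refl
topView-fromℕ (suc k) rewrite topView-fromℕ k = refl

topView-inject₁ : ∀ {k} (x : Fin k) → topView (inject₁ x) ≡ low x
topView-inject₁ {suc k} fz = refl
topView-inject₁ {suc k} (fs x) rewrite topView-inject₁ x = refl

caseTop : ∀ {k} {B : Set} → B → (Fin k → B) → Fin (suc k) → B
caseTop t l i with topView i
... | top = t
... | low x = l x

caseTop-top : ∀ {k} {B : Set} (t : B) (l : Fin k → B) → caseTop t l (fromℕ k) ≡ t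
caseTop-top {k} t l rewrite topView-fromℕ k = refl

caseTop-low : ∀ {k} {B : Set} (t : B) (l : Fin k → B) x → caseTop t l (inject₁ x) ≡ l x
caseTop-low t l x rewrite topView-inject₁ x = refl

top-or-low : ∀ {k} {P : Fin (suc k) → Set} → P (fromℕ k) → (∀ x → P (inject₁ x)) → ∀ i → P i
top-or-low Ptop Plow i with topView i
... | top = Ptop
... | low x = Plow x

top-or-low₂ : ∀ {k} {P : Fin (suc k) → Fin (suc k) → Set} →
  P (fromℕ k) (fromℕ k) → (∀ y → P (fromℕ k) (inject₁ y)) →
  (∀ x → P (inject₁ x) (fromℕ k)) → (∀ x y → P (inject₁ x) (inject₁ y)) → ∀ i j → P i j
top-or-low₂ {P = P} Ptt Ptl Plt Pll i j =
  top-or-low {P = λ i → P i j} (top-or-low (Ptt) Ptl j) (λ x → top-or-low (Plt x) (Pll x) j) i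

extend : ∀ {k} → Mat k → (Fin k → ℤ) → Mat (suc k)
extend e γ i j = caseTop (caseTop 0ℤ (λ y → - γ y) j) (λ x → caseTop (γ x) (e x) j) i

module _ {k} (e : Mat k) (γ : Fin k → ℤ) where

  extend-top-top : extend e γ (fromℕ k) (fromℕ k) ≡ 0ℤ
  extend-top-top rewrite caseTop-top (caseTop 0ℤ (λ y → - γ y) (fromℕ k)) (λ x → caseTop (γ x) (e x) (fromℕ k)) =
    caseTop-top 0ℤ (λ y → - γ y)

  extend-top-low : ∀ y → extend e γ (fromℕ k) (inject₁ y) ≡ - γ y
  extend-top-low y rewrite caseTop-top (caseTop 0ℤ (λ y → - γ y) (inject₁ y)) (λ x → caseTop (γ x) (e x) (inject₁ y)) =
    caseTop-low 0ℤ _ y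

  extend-low-top : ∀ x → extend e γ (inject₁ x) (fromℕ k) ≡ γ x
  extend-low-top x rewrite caseTop-low (caseTop 0ℤ (λ y → - γ y) (fromℕ k)) (λ x → caseTop (γ x) (e x) (fromℕ k)) x =
    caseTop-top (γ x) (e x)

  extend-low-low : ∀ x y → extend e γ (inject₁ x) (inject₁ y) ≡ e x y
  extend-low-low x y rewrite caseTop-low (caseTop 0ℤ (λ y → - γ y) (inject₁ y)) (λ x → caseTop (γ x) (e x) (inject₁ y)) x =
    caseTop-low (γ x) (e x) y

extend-cong : ∀ {k} (e : Mat k) {γ γ' : Fin k → ℤ} → (∀ x → γ x ≡ γ' x) → extend e γ ≐ extend e γ'
extend-cong {k} e {γ} {γ'} γ≗γ' = top-or-low₂ {P = λ i j → extend e γ i j ≡ extend e γ' i j}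
  (trans (extend-top-top e γ) (sym (extend-top-top e γ')))
  (λ y → trans (extend-top-low e γ y) (trans (cong -_ (γ≗γ' y)) (sym (extend-top-low e γ' y))))
  (λ x → trans (extend-low-top e γ x) (trans (γ≗γ' x) (sym (extend-low-top e γ' x))))
  (λ x y → trans (extend-low-low e γ x y) (sym (extend-low-low e γ' x y)))

extend-skew : ∀ {k} {e : Mat k} γ → Skew e → Skew (extend e γ)
extend-skew {k} {e} γ skew = top-or-low₂ {P = λ i j → extend e γ j i ≡ - extend e γ i j}
  (trans (extend-top-top e γ) (sym (cong -_ (extend-top-top e γ))))
  (λ y → trans (extend-low-top e γ y) (trans (sym (ℤ.neg-involutive (γ y))) (cong -_ (sym (extend-top-low e γ y)))))
  (λ x → trans (extend-top-low e γ x) (cong -_ (sym (extend-low-top e γ x))))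
  (λ x y → trans (extend-low-low e γ y x) (trans (skew x y) (cong -_ (sym (extend-low-low e γ x y)))))

indicator-top-inject₁ : ∀ {k} (x : Fin k) → indicator (fromℕ k) (inject₁ x) ≡ false
indicator-top-inject₁ x = dec-false (fromℕ _ Fin.≟ inject₁ x) Fin.fromℕ≢inject₁

flipᴹ-top-extend : ∀ {k} (e : Mat k) γ → flipᴹ (indicator (fromℕ k)) (extend e γ) ≐ extend e (λ x → - γ x)
flipᴹ-top-extend {k} e γ = top-or-low₂ {P = λ i j → flipᴹ (indicator (fromℕ k)) (extend e γ) i j ≡ extend e γ′ i j}
  top-top top-low low-top low-low
  where
  γ′ : Fin k → ℤ
  γ′ x = - γ x
  top-top : flipᴹ (indicator (fromℕ k)) (extend e γ) (fromℕ k) (fromℕ k) ≡ extend e γ′ (fromℕ k) (fromℕ k)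
  top-top rewrite dec-true (fromℕ k Fin.≟ fromℕ k) refl | extend-top-top e γ | extend-top-top e γ′ = refl
  top-low : ∀ y → flipᴹ (indicator (fromℕ k)) (extend e γ) (fromℕ k) (inject₁ y) ≡ extend e γ′ (fromℕ k) (inject₁ y)
  top-low y rewrite dec-true (fromℕ k Fin.≟ fromℕ k) refl | indicator-top-inject₁ y
    | extend-top-low e γ y | extend-top-low e γ′ y = refl
  low-top : ∀ x → flipᴹ (indicator (fromℕ k)) (extend e γ) (inject₁ x) (fromℕ k) ≡ extend e γ′ (inject₁ x) (fromℕ k)
  low-top x rewrite dec-true (fromℕ k Fin.≟ fromℕ k) refl | indicator-top-inject₁ x
    | extend-low-top e γ x | extend-low-top e γ′ x = refl
  low-low : ∀ x y → flipᴹ (indicator (fromℕ k)) (extend e γ) (inject₁ x) (inject₁ y) ≡ extend e γ′ (inject₁ x) (inject₁ y)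
  low-low x y rewrite indicator-top-inject₁ x | indicator-top-inject₁ y
    | extend-low-low e γ x y | extend-low-low e γ′ x y = refl

roundBlock-extend : ∀ {k} a (p : Fin (suc k) → ℤ × ℤ) (e : Mat k) γ →
  (∀ x y → roundCorrection a (p (inject₁ x)) (p (inject₁ y)) ≡ 0ℤ) →
  roundBlock a p (extend e γ) ≐ extend e (λ x → γ x + roundCorrection a (p (inject₁ x)) (p (fromℕ k)))
roundBlock-extend {k} a p e γ lowCorr≡0 = top-or-low₂ {P = λ i j → roundBlock a p (extend e γ) i j ≡ extend e γ′ i j}
  (begin
    extend e γ (fromℕ k) (fromℕ k) + corr (fromℕ k) (fromℕ k)
      ≡⟨ cong₂ _+_ (extend-top-top e γ) (roundCorrection-self a (p (fromℕ k))) ⟩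
    0ℤ                                                          ≡⟨ extend-top-top e γ′ ⟨
    extend e γ′ (fromℕ k) (fromℕ k)                             ∎)
  (λ y → begin
    extend e γ (fromℕ k) (inject₁ y) + corr (fromℕ k) (inject₁ y)
      ≡⟨ cong₂ _+_ (extend-top-low e γ y) (roundCorrection-antisym a (p (inject₁ y)) (p (fromℕ k))) ⟩
    - γ y + - corr (inject₁ y) (fromℕ k)   ≡⟨ ℤ.neg-distrib-+ (γ y) (corr (inject₁ y) (fromℕ k)) ⟨
    - γ′ y                                 ≡⟨ extend-top-low e γ′ y ⟨
    extend e γ′ (fromℕ k) (inject₁ y)      ∎)
  (λ x → trans (cong (_+ corr (inject₁ x) (fromℕ k)) (extend-low-top e γ x)) (sym (extend-low-top e γ′ x)))
  (λ x y → begin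
    extend e γ (inject₁ x) (inject₁ y) + corr (inject₁ x) (inject₁ y)  ≡⟨ cong₂ _+_ (extend-low-low e γ x y) (lowCorr≡0 x y) ⟩
    e x y + 0ℤ                                                          ≡⟨ ℤ.+-identityʳ (e x y) ⟩
    e x y                                                               ≡⟨ extend-low-low e γ′ x y ⟨
    extend e γ′ (inject₁ x) (inject₁ y)                                 ∎)
  where
  corr : Fin (suc k) → Fin (suc k) → ℤ
  corr r s = roundCorrection a (p r) (p s)
  γ′ : Fin k → ℤ
  γ′ x = γ x + corr (inject₁ x) (fromℕ k)

-- The vertices 3, …, n − 1 are lowᵥ x and n is N. The full subquiver on [1, n − 1] is R̃ after k rounds:
-- b₁₂ = a, the columns Tᵏ (p₀ x) and the block e₀; (f₁, f₂, f) is the column of N.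
module Cycle
  (m : ℕ) {a : ℤ} (a≥2 : + 2 ≤ℤ a) (k' : ℕ)
  (p₀ : Fin (suc m) → ℤ × ℤ) (p₀≥ : ∀ x → 0ℤ ≤ℤ proj₁ (p₀ x) × + 1 ≤ℤ proj₂ (p₀ x))
  (e₀ : Mat (suc m)) (e₀-skew : Skew e₀) (e₀≥0 : ∀ x y → toℕ x ℕ.< toℕ y → 0ℤ ≤ℤ e₀ x y)
  (f₁ f₂ : ℤ) (f₁≥1 : + 1 ≤ℤ f₁) (f₂≥0 : 0ℤ ≤ℤ f₂)
  (f : Fin (suc m) → ℤ) (f≥0 : ∀ x → 0ℤ ≤ℤ f x)
  where

  k : ℕ
  k = suc k'

  n : ℕ
  n = suc (suc (suc (suc m)))

  Vertex : Set
  Vertex = Fin n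

  ⊤ᵒ : Fin (suc (suc m))
  ⊤ᵒ = fromℕ (suc m)

  N : Vertex
  N = other ⊤ᵒ

  lowᵥ : Fin (suc m) → Vertex
  lowᵥ x = other (inject₁ x)

  a≥0 : 0ℤ ≤ℤ a
  a≥0 = ℤ.≤-trans (+≤+ z≤n) a≥2

  a≢0 : a ≢ 0ℤ
  a≢0 = 1≤i⇒i≢0 (ℤ.≤-trans (+≤+ (s≤s z≤n)) a≥2)

  topOrbit : ℕ → ℤ × ℤ
  topOrbit i = fold (f₂ , f₁) (T a) i

  lowOrbit : ℕ → Fin (suc m) → ℤ × ℤ
  lowOrbit j x = fold (p₀ x) (T a) j

  Growing-topOrbit : ∀ i → Growing a (topOrbit i)
  Growing-topOrbit i = Growing-fold a≥2 i (Growing-init a≥2 f₂≥0 f₁≥1)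

  Growing-lowOrbit : ∀ j x → Growing a (lowOrbit j x)
  Growing-lowOrbit j x = Growing-fold a≥2 j (Growing-init a≥2 (proj₁ (p₀≥ x)) (proj₂ (p₀≥ x)))

  columns : ℕ → ℕ → Fin (suc (suc m)) → ℤ × ℤ
  columns j i = caseTop (negSwap (topOrbit i)) (lowOrbit j)

  -- Apart from the descending sinks, every quiver met along the cycle is a Stage.
  Stage : ℕ → ℕ → (Fin (suc m) → ℤ) → Mat n
  Stage j i γ = bordered a (columns j i) (extend e₀ γ)

  initialColumns : Fin (suc (suc m)) → ℤ × ℤ
  initialColumns = caseTop (f₁ , f₂) (lowOrbit k)

  M : Mat n
  M = bordered a initialColumns (extend e₀ f)

  M-skew : Skew M
  M-skew = bordered-skew a initialColumns (extend-skew f e₀-skew)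

  f⁻ : Fin (suc m) → ℤ
  f⁻ x = - f x

  sinkAtN : M ─[ [ N ] ]→ Stage k 0 f⁻
  sinkAtN = ─[]→-single N v₁ Mv₁N≢0
    (≐-trans (μᴹ-sink N M-skew column≥0)
    (≐-trans (flipᴹ-cong indicatorN≗ ≐-refl)
    (≐-trans (flipᴹ-bordered (indicator ⊤ᵒ) a initialColumns (extend e₀ f))
    (bordered-cong refl columns≗ (flipᴹ-top-extend e₀ f)))))
    where
    Mv₁N≡f₁ : M v₁ N ≡ f₁
    Mv₁N≡f₁ = cong proj₁ (caseTop-top (f₁ , f₂) (lowOrbit k))
    Mv₁N≢0 : M v₁ N ≢ 0ℤ
    Mv₁N≢0 Mv₁N≡0 = 1≤i⇒i≢0 f₁≥1 (trans (sym Mv₁N≡f₁) Mv₁N≡0)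
    column≥0 : ∀ i → 0ℤ ≤ℤ M i N
    column≥0 v₁ = subst (0ℤ ≤ℤ_) (sym Mv₁N≡f₁) (ℤ.≤-trans (+≤+ z≤n) f₁≥1)
    column≥0 v₂ = subst (0ℤ ≤ℤ_) (sym (cong proj₂ (caseTop-top (f₁ , f₂) (lowOrbit k)))) f₂≥0
    column≥0 (other r) = top-or-low {P = λ r → 0ℤ ≤ℤ extend e₀ f r ⊤ᵒ}
      (subst (0ℤ ≤ℤ_) (sym (extend-top-top e₀ f)) (+≤+ z≤n))
      (λ x → subst (0ℤ ≤ℤ_) (sym (extend-low-top e₀ f x)) (f≥0 x)) r
    indicatorN≗ : ∀ i → indicator N i ≡ onOthers (indicator ⊤ᵒ) i
    indicatorN≗ v₁ = refl
    indicatorN≗ v₂ = refl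
    indicatorN≗ (other r) = refl
    columns≗ : ∀ r → ±-pair (indicator ⊤ᵒ r) (initialColumns r) ≡ columns k 0 r
    columns≗ = top-or-low {P = λ r → ±-pair (indicator ⊤ᵒ r) (initialColumns r) ≡ columns k 0 r}
      (trans (cong₂ ±-pair (dec-true (⊤ᵒ Fin.≟ ⊤ᵒ) refl) (caseTop-top (f₁ , f₂) (lowOrbit k)))
             (sym (caseTop-top (negSwap (topOrbit 0)) (lowOrbit k))))
      (λ x → trans (cong₂ ±-pair (indicator-top-inject₁ x) (caseTop-low (f₁ , f₂) (lowOrbit k) x))
             (sym (caseTop-low (negSwap (topOrbit 0)) (lowOrbit k) x)))

  columns-top : ∀ j i → columns j i ⊤ᵒ ≡ negSwap (topOrbit i)
  columns-top j i = caseTop-top (negSwap (topOrbit i)) (lowOrbit j)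

  columns-low : ∀ j i x → columns j i (inject₁ x) ≡ lowOrbit j x
  columns-low j i x = caseTop-low (negSwap (topOrbit i)) (lowOrbit j) x

  round-Stage : ∀ j i γ → Stage j (suc i) γ ─[ v₂ ∷ v₁ ∷ [] ]→ Stage (suc j) i γ
  round-Stage j i γ = ─[]→-congʳ (v₂ ∷ v₁ ∷ []) (bordered-cong refl advance ≐-refl)
    (round-Forward (columns j (suc i)) (extend e₀ γ) a≥0 a≢0 forward)
    where
    forward : ∀ r → Forward a (columns j (suc i) r)
    forward = top-or-low {P = λ r → Forward a (columns j (suc i) r)}
      (subst (Forward a) (sym (columns-top j (suc i))) (Growing⇒Forward-negSwap-T a (topOrbit i) (Growing-topOrbit i)))
      (λ x → subst (Forward a) (sym (columns-low j (suc i) x)) (Growing⇒Forward a (lowOrbit j x) (Growing-lowOrbit j x)))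
    advance : ∀ r → T a (columns j (suc i) r) ≡ columns (suc j) i r
    advance = top-or-low {P = λ r → T a (columns j (suc i) r) ≡ columns (suc j) i r}
      (trans (cong (T a) (columns-top j (suc i))) (trans (T-negSwap-T a (topOrbit i)) (sym (columns-top (suc j) i))))
      (λ x → trans (cong (T a) (columns-low j (suc i) x)) (sym (columns-low (suc j) i x)))

  inverseRounds : ∀ j i γ → Stage j i γ ─[ concat (replicate j (v₁ ∷ v₂ ∷ [])) ]→ Stage 0 (j ℕ.+ i) γ
  inverseRounds zero i γ = ─[]→-refl ≐-refl
  inverseRounds (suc j) i γ = ─[]→-trans (v₁ ∷ v₂ ∷ []) (concat (replicate j (v₁ ∷ v₂ ∷ [])))
    (round⁻¹ a≢0 (proj₂ (round-Stage j i γ)))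
    (subst (λ l → Stage j (suc i) γ ─[ concat (replicate j (v₁ ∷ v₂ ∷ [])) ]→ Stage 0 l γ) (ℕ.+-suc j i)
      (inverseRounds j (suc i) γ))

  Final : ℕ → (Fin (suc m) → ℤ) → Mat n
  Final l γ = bordered a (caseTop (f₁ , f₂) (lowOrbit (suc l))) (extend e₀ (λ x → γ x + - form a (lowOrbit l x) (f₂ , f₁)))

  lastRound : ∀ l γ → Stage l 0 γ ─[ v₂ ∷ v₁ ∷ [] ]→ Final l γ
  lastRound l γ = ─[]→-congʳ (v₂ ∷ v₁ ∷ [])
    (bordered-cong refl columns≗ (≐-trans (roundBlock-extend a p e₀ γ lowCorr≡0) (extend-cong e₀ corr≗)))
    (round a p (extend e₀ γ) a≢0)
    where
    p : Fin (suc (suc m)) → ℤ × ℤ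
    p = columns l 0
    backward : Backward (p ⊤ᵒ)
    backward = subst Backward (sym (columns-top l 0))
      (ℤ.neg-mono-≤ (ℤ.≤-trans (+≤+ z≤n) f₁≥1) , ℤ.neg-mono-≤ f₂≥0)
    forward : ∀ x → Forward a (p (inject₁ x))
    forward x = subst (Forward a) (sym (columns-low l 0 x)) (Growing⇒Forward a (lowOrbit l x) (Growing-lowOrbit l x))
    lowCorr≡0 : ∀ x y → roundCorrection a (p (inject₁ x)) (p (inject₁ y)) ≡ 0ℤ
    lowCorr≡0 x y = roundCorrection-FF a≥0 (p (inject₁ x)) (p (inject₁ y)) (forward x) (forward y)
    corr≗ : ∀ x → γ x + roundCorrection a (p (inject₁ x)) (p ⊤ᵒ) ≡ γ x + - form a (lowOrbit l x) (f₂ , f₁)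
    corr≗ x = cong (λ z → γ x + z) (begin
      roundCorrection a (p (inject₁ x)) (p ⊤ᵒ)      ≡⟨ roundCorrection-FB a≥0 (p (inject₁ x)) (p ⊤ᵒ) (forward x) backward ⟩
      cross a (p (inject₁ x)) (p ⊤ᵒ)                ≡⟨ cong₂ (cross a) (columns-low l 0 x) (columns-top l 0) ⟩
      cross a (lowOrbit l x) (negSwap (f₂ , f₁))        ≡⟨ cross-negSwap a (lowOrbit l x) (f₂ , f₁) ⟩
      - form a (lowOrbit l x) (f₂ , f₁)                 ∎)
    columns≗ : ∀ r → roundPair a (p r) ≡ caseTop (f₁ , f₂) (lowOrbit (suc l)) r
    columns≗ = top-or-low {P = λ r → roundPair a (p r) ≡ caseTop (f₁ , f₂) (lowOrbit (suc l)) r}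
      (begin
        roundPair a (p ⊤ᵒ)                     ≡⟨ roundPair-Backward a≥0 (p ⊤ᵒ) backward ⟩
        (- proj₁ (p ⊤ᵒ) , - proj₂ (p ⊤ᵒ))      ≡⟨ cong (λ v → (- proj₁ v , - proj₂ v)) (columns-top l 0) ⟩
        (- - f₁ , - - f₂)                      ≡⟨ cong₂ _,_ (ℤ.neg-involutive f₁) (ℤ.neg-involutive f₂) ⟩
        (f₁ , f₂)                              ≡⟨ caseTop-top (f₁ , f₂) (lowOrbit (suc l)) ⟨
        caseTop (f₁ , f₂) (lowOrbit (suc l)) ⊤ᵒ    ∎)
      (λ x → begin
        roundPair a (p (inject₁ x))                     ≡⟨ roundPair-Forward a≥0 (p (inject₁ x)) (forward x) ⟩
        T a (p (inject₁ x))                             ≡⟨ cong (T a) (columns-low l 0 x) ⟩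
        lowOrbit (suc l) x                                  ≡⟨ caseTop-low (f₁ , f₂) (lowOrbit (suc l)) x ⟨
        caseTop (f₁ , f₂) (lowOrbit (suc l)) (inject₁ x)    ∎)

  forwardRounds : ∀ i j γ → Stage j i γ ─[ concat (replicate (suc i) (v₂ ∷ v₁ ∷ [])) ]→ Final (i ℕ.+ j) γ
  forwardRounds zero j γ = ─[]→-trans (v₂ ∷ v₁ ∷ []) [] (lastRound j γ) (─[]→-refl ≐-refl)
  forwardRounds (suc i) j γ = ─[]→-trans (v₂ ∷ v₁ ∷ []) (concat (replicate (suc i) (v₂ ∷ v₁ ∷ [])))
    (round-Stage j i γ)
    (subst (λ l → Stage (suc j) i γ ─[ concat (replicate (suc i) (v₂ ∷ v₁ ∷ [])) ]→ Final l γ) (ℕ.+-suc i j)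
      (forwardRounds i (suc j) γ))

  Stage-skew : ∀ j i γ → Skew (Stage j i γ)
  Stage-skew j i γ = bordered-skew a (columns j i) (extend-skew γ e₀-skew)

  flippedFrom : ℕ → Fin (suc (suc m)) → Bool
  flippedFrom t = caseTop false (λ y → t ℕ.≤ᵇ toℕ y)

  -- Stage 0 k (−f) after the sinks at the low vertices x with toℕ x ≥ t, which only flipped their signs.
  Flipped : ℕ → Mat n
  Flipped t = flipᴹ (onOthers (flippedFrom t)) (Stage 0 k f⁻)

  flippedFrom-top : ∀ t → flippedFrom t ⊤ᵒ ≡ false
  flippedFrom-top t = caseTop-top {suc m} false (λ y → t ℕ.≤ᵇ toℕ y)

  flippedFrom-low : ∀ t y → flippedFrom t (inject₁ y) ≡ (t ℕ.≤ᵇ toℕ y)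
  flippedFrom-low t y = caseTop-low false (λ y → t ℕ.≤ᵇ toℕ y) y

  flippedFrom-step : ∀ x r → indicator (inject₁ x) r xor flippedFrom (suc (toℕ x)) r ≡ flippedFrom (toℕ x) r
  flippedFrom-step x = top-or-low {P = λ r → indicator (inject₁ x) r xor flippedFrom (suc (toℕ x)) r ≡ flippedFrom (toℕ x) r}
    (begin
      indicator (inject₁ x) ⊤ᵒ xor flippedFrom (suc (toℕ x)) ⊤ᵒ
        ≡⟨ cong₂ _xor_ (dec-false (inject₁ x Fin.≟ ⊤ᵒ) (λ x≡⊤ → Fin.fromℕ≢inject₁ (sym x≡⊤)))
                       (flippedFrom-top (suc (toℕ x))) ⟩
      false                     ≡⟨ flippedFrom-top (toℕ x) ⟨
      flippedFrom (toℕ x) ⊤ᵒ    ∎)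
    (λ y → trans (cong (indicator (inject₁ x) (inject₁ y) xor_) (flippedFrom-low (suc (toℕ x)) y))
           (trans (atLow y) (sym (flippedFrom-low (toℕ x) y))))
    where
    -- does (m ℕ.≤? n) reduces to m ℕ.≤ᵇ n, so dec-true/dec-false evaluate flippedFrom.
    atLow : ∀ y → indicator (inject₁ x) (inject₁ y) xor (suc (toℕ x) ℕ.≤ᵇ toℕ y) ≡ (toℕ x ℕ.≤ᵇ toℕ y)
    atLow y with ℕ.<-cmp (toℕ x) (toℕ y)
    ... | tri< x<y _ _ = begin
      indicator (inject₁ x) (inject₁ y) xor (suc (toℕ x) ℕ.≤ᵇ toℕ y)
        ≡⟨ cong₂ _xor_ (dec-false (inject₁ x Fin.≟ inject₁ y) λ x≡y → ℕ.<⇒≢ x<y (cong toℕ (Fin.inject₁-injective x≡y)))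
                       (dec-true (suc (toℕ x) ℕ.≤? toℕ y) x<y) ⟩
      true   ≡⟨ dec-true (toℕ x ℕ.≤? toℕ y) (ℕ.<⇒≤ x<y) ⟨
      (toℕ x ℕ.≤ᵇ toℕ y) ∎
    ... | tri≈ _ x≡y _ rewrite Fin.toℕ-injective x≡y = begin
      indicator (inject₁ y) (inject₁ y) xor (suc (toℕ y) ℕ.≤ᵇ toℕ y)
        ≡⟨ cong₂ _xor_ (dec-true (inject₁ y Fin.≟ inject₁ y) refl) (dec-false (suc (toℕ y) ℕ.≤? toℕ y) (ℕ.<-irrefl refl)) ⟩
      true   ≡⟨ dec-true (toℕ y ℕ.≤? toℕ y) ℕ.≤-refl ⟨
      (toℕ y ℕ.≤ᵇ toℕ y) ∎
    ... | tri> _ _ y<x = begin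
      indicator (inject₁ x) (inject₁ y) xor (suc (toℕ x) ℕ.≤ᵇ toℕ y)
        ≡⟨ cong₂ _xor_ (dec-false (inject₁ x Fin.≟ inject₁ y) λ x≡y → ℕ.<⇒≢ y<x (sym (cong toℕ (Fin.inject₁-injective x≡y))))
                       (dec-false (suc (toℕ x) ℕ.≤? toℕ y) (ℕ.<-asym y<x)) ⟩
      false  ≡⟨ dec-false (toℕ x ℕ.≤? toℕ y) (ℕ.<⇒≱ y<x) ⟨
      (toℕ x ℕ.≤ᵇ toℕ y) ∎

  x-unflipped : ∀ x → flippedFrom (suc (toℕ x)) (inject₁ x) ≡ false
  x-unflipped x = trans (flippedFrom-low (suc (toℕ x)) x) (dec-false (suc (toℕ x) ℕ.≤? toℕ x) (ℕ.<-irrefl refl))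

  Flipped-column : ∀ x i →
    Flipped (suc (toℕ x)) i (lowᵥ x) ≡ ±[ onOthers (flippedFrom (suc (toℕ x))) i ] (Stage 0 k f⁻ i (lowᵥ x))
  Flipped-column x i = cong (λ b → ±[ onOthers (flippedFrom (suc (toℕ x))) i ] (±[ b ] (Stage 0 k f⁻ i (lowᵥ x))))
    (x-unflipped x)

  flippedLow≥0 : ∀ x y → 0ℤ ≤ℤ ±[ suc (toℕ x) ℕ.≤ᵇ toℕ y ] (e₀ y x)
  flippedLow≥0 x y with ℕ.<-cmp (toℕ y) (toℕ x)
  ... | tri< y<x _ _ rewrite dec-false (suc (toℕ x) ℕ.≤? toℕ y) (ℕ.<-asym y<x) = e₀≥0 y x y<x
  ... | tri≈ _ y≡x _ rewrite Fin.toℕ-injective y≡x | dec-false (suc (toℕ x) ℕ.≤? toℕ x) (ℕ.<-irrefl refl) =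
    subst (0ℤ ≤ℤ_) (sym (Skew⇒diag≡0 e₀-skew x)) (+≤+ z≤n)
  ... | tri> _ _ x<y rewrite dec-true (suc (toℕ x) ℕ.≤? toℕ y) x<y =
    subst (0ℤ ≤ℤ_) (e₀-skew y x) (e₀≥0 x y x<y)

  Flipped-column≥0 : ∀ x i → 0ℤ ≤ℤ Flipped (suc (toℕ x)) i (lowᵥ x)
  Flipped-column≥0 x i rewrite Flipped-column x i = column i
    where
    p₀x≡ : columns 0 k (inject₁ x) ≡ p₀ x
    p₀x≡ = columns-low 0 k x
    column : ∀ i → 0ℤ ≤ℤ ±[ onOthers (flippedFrom (suc (toℕ x))) i ] (Stage 0 k f⁻ i (lowᵥ x))
    column v₁ = subst (0ℤ ≤ℤ_) (sym (cong proj₁ p₀x≡)) (proj₁ (p₀≥ x))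
    column v₂ = subst (0ℤ ≤ℤ_) (sym (cong proj₂ p₀x≡)) (ℤ.≤-trans (+≤+ z≤n) (proj₂ (p₀≥ x)))
    column (other r) = top-or-low {P = λ r → 0ℤ ≤ℤ ±[ flippedFrom (suc (toℕ x)) r ] (extend e₀ f⁻ r (inject₁ x))}
      (subst (0ℤ ≤ℤ_)
        (sym (cong₂ ±[_] (flippedFrom-top (suc (toℕ x))) (trans (extend-top-low e₀ f⁻ x) (ℤ.neg-involutive (f x)))))
        (f≥0 x))
      (λ y → subst (0ℤ ≤ℤ_) (sym (cong₂ ±[_] (flippedFrom-low (suc (toℕ x)) y) (extend-low-low e₀ f⁻ y x)))
                          (flippedLow≥0 x y))
      r

  sinkStep : ∀ x → Flipped (suc (toℕ x)) ─[ [ lowᵥ x ] ]→ Flipped (toℕ x)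
  sinkStep x = ─[]→-single (lowᵥ x) v₂ entry≢0
    (≐-trans (μᴹ-sink (lowᵥ x) (flipᴹ-skew σ (Stage-skew 0 k f⁻)) (Flipped-column≥0 x))
    (≐-trans (flipᴹ-flipᴹ (indicator (lowᵥ x)) σ (Stage 0 k f⁻))
    (flipᴹ-cong step ≐-refl)))
    where
    σ : Vertex → Bool
    σ = onOthers (flippedFrom (suc (toℕ x)))
    entry≢0 : Flipped (suc (toℕ x)) v₂ (lowᵥ x) ≢ 0ℤ
    entry≢0 = subst (_≢ 0ℤ) (sym (trans (Flipped-column x v₂) (cong proj₂ (columns-low 0 k x))))
      (1≤i⇒i≢0 (proj₂ (p₀≥ x)))
    step : ∀ i → indicator (lowᵥ x) i xor σ i ≡ onOthers (flippedFrom (toℕ x)) i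
    step v₁ = refl
    step v₂ = refl
    step (other r) = flippedFrom-step x r

  sinkCascade : ∀ l o (g : Fin l → Fin (suc m)) → (∀ i → toℕ (g i) ≡ o ℕ.+ toℕ i) →
    Flipped (o ℕ.+ l) ─[ reverse (tabulate (λ i → lowᵥ (g i))) ]→ Flipped o
  sinkCascade zero o g g≡ = ─[]→-refl (subst (λ t → Flipped t ≐ Flipped o) (sym (ℕ.+-identityʳ o)) ≐-refl)
  sinkCascade (suc l) o g g≡ =
    subst (λ ks → Flipped (o ℕ.+ suc l) ─[ ks ]→ Flipped o) (sym (List.unfold-reverse (lowᵥ (g fz)) rest))
      (─[]→-trans (reverse rest) [ lowᵥ (g fz) ] higher lowest)
    where
    rest : List Vertex
    rest = tabulate (λ i → lowᵥ (g (fs i)))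
    higher : Flipped (o ℕ.+ suc l) ─[ reverse rest ]→ Flipped (suc o)
    higher = subst (λ t → Flipped t ─[ reverse rest ]→ Flipped (suc o)) (sym (ℕ.+-suc o l))
      (sinkCascade l (suc o) (λ i → g (fs i)) (λ i → trans (g≡ (fs i)) (ℕ.+-suc o (toℕ i))))
    lowest : Flipped (suc o) ─[ [ lowᵥ (g fz) ] ]→ Flipped o
    lowest = subst (λ t → Flipped (suc t) ─[ [ lowᵥ (g fz) ] ]→ Flipped t) (trans (g≡ fz) (ℕ.+-identityʳ o)) (sinkStep (g fz))

  sinks : Stage 0 k f⁻ ─[ reverse (tabulate lowᵥ) ]→ Flipped 0
  sinks = ─[]→-congˡ (reverse (tabulate lowᵥ)) (flipᴹ-cong noneFlipped ≐-refl)
    (sinkCascade (suc m) 0 (λ x → x) (λ _ → refl))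
    where
    noneFlipped : ∀ i → onOthers (flippedFrom (suc m)) i ≡ false
    noneFlipped v₁ = refl
    noneFlipped v₂ = refl
    noneFlipped (other r) = top-or-low {P = λ r → flippedFrom (suc m) r ≡ false} (flippedFrom-top (suc m))
      (λ y → trans (flippedFrom-low (suc m) y) (dec-false (suc m ℕ.≤? toℕ y) (ℕ.<⇒≱ (Fin.toℕ<n y)))) r

  γ₃ : Fin (suc m) → ℤ
  γ₃ x = f x + form a (p₀ x) (topOrbit k')

  pivotColumns : Fin (suc (suc m)) → ℤ × ℤ
  pivotColumns r = ±-pair (flippedFrom 0 r) (columns 0 k r)

  pivotColumns-top : pivotColumns ⊤ᵒ ≡ negSwap (T a (topOrbit k'))
  pivotColumns-top = cong₂ ±-pair (flippedFrom-top 0) (columns-top 0 k)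

  pivotColumns-low : ∀ x → pivotColumns (inject₁ x) ≡ ±-pair true (p₀ x)
  pivotColumns-low x = cong₂ ±-pair (flippedFrom-low 0 x) (columns-low 0 k x)

  pivotColumns-Forward : Forward a (pivotColumns ⊤ᵒ)
  pivotColumns-Forward = subst (Forward a) (sym pivotColumns-top)
    (Growing⇒Forward-negSwap-T a (topOrbit k') (Growing-topOrbit k'))

  pivotColumns-Backward : ∀ x → Backward (pivotColumns (inject₁ x))
  pivotColumns-Backward x = subst Backward (sym (pivotColumns-low x))
    (ℤ.neg-mono-≤ (proj₁ (p₀≥ x)) , ℤ.neg-mono-≤ (ℤ.≤-trans (+≤+ z≤n) (proj₂ (p₀≥ x))))

  Flipped0≐ : Flipped 0 ≐ bordered a pivotColumns (extend e₀ (λ x → - f⁻ x))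
  Flipped0≐ = ≐-trans (flipᴹ-bordered (flippedFrom 0) a (columns 0 k) (extend e₀ f⁻))
    (bordered-cong refl (λ _ → refl)
      (≐-trans (flipᴹ-cong allLowsFlipped ≐-refl)
      (≐-trans (flipᴹ-not (indicator ⊤ᵒ) (extend e₀ f⁻)) (flipᴹ-top-extend e₀ f⁻))))
    where
    allLowsFlipped : ∀ r → flippedFrom 0 r ≡ not (indicator ⊤ᵒ r)
    allLowsFlipped = top-or-low {P = λ r → flippedFrom 0 r ≡ not (indicator ⊤ᵒ r)}
      (trans (flippedFrom-top 0) (cong not (sym (dec-true (⊤ᵒ Fin.≟ ⊤ᵒ) refl))))
      (λ y → trans (flippedFrom-low 0 y) (cong not (sym (indicator-top-inject₁ y))))

  -- The round in which the low columns are Backward; it adds form a (p₀ x) (topOrbit k') to the column of N.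
  pivotRound : Flipped 0 ─[ v₂ ∷ v₁ ∷ [] ]→ Stage 0 k' γ₃
  pivotRound = ─[]→-congˡ (v₂ ∷ v₁ ∷ []) (≐-sym Flipped0≐)
    (─[]→-congʳ (v₂ ∷ v₁ ∷ [])
      (bordered-cong refl columns≗ (≐-trans (roundBlock-extend a p e₀ (λ x → - f⁻ x) lowCorr≡0) (extend-cong e₀ corr≗)))
      (round a p (extend e₀ (λ x → - f⁻ x)) a≢0))
    where
    p : Fin (suc (suc m)) → ℤ × ℤ
    p = pivotColumns
    lowCorr≡0 : ∀ x y → roundCorrection a (p (inject₁ x)) (p (inject₁ y)) ≡ 0ℤ
    lowCorr≡0 x y = roundCorrection-BB a≥0 (p (inject₁ x)) (p (inject₁ y)) (pivotColumns-Backward x) (pivotColumns-Backward y)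
    corr≗ : ∀ x → - f⁻ x + roundCorrection a (p (inject₁ x)) (p ⊤ᵒ) ≡ γ₃ x
    corr≗ x = begin
      - - f x + roundCorrection a (p (inject₁ x)) (p ⊤ᵒ)
        ≡⟨ cong (λ z → - - f x + z) (roundCorrection-BF a≥0 (p (inject₁ x)) (p ⊤ᵒ) (pivotColumns-Backward x) pivotColumns-Forward) ⟩
      - - f x + - cross a (p ⊤ᵒ) (p (inject₁ x))
        ≡⟨ cong₂ (λ v w → - - f x + - cross a v w) pivotColumns-top (pivotColumns-low x) ⟩
      - - f x + - cross a (negSwap (T a (topOrbit k'))) (±-pair true (p₀ x))
        ≡⟨ cong (λ z → - - f x + - z) (cross-negSwap-T a (topOrbit k') (p₀ x)) ⟩
      - - f x + - - form a (p₀ x) (topOrbit k')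
        ≡⟨ cong₂ _+_ (ℤ.neg-involutive (f x)) (ℤ.neg-involutive _) ⟩
      γ₃ x ∎
    columns≗ : ∀ r → roundPair a (p r) ≡ columns 0 k' r
    columns≗ = top-or-low {P = λ r → roundPair a (p r) ≡ columns 0 k' r}
      (begin
        roundPair a (p ⊤ᵒ)                   ≡⟨ roundPair-Forward a≥0 (p ⊤ᵒ) pivotColumns-Forward ⟩
        T a (p ⊤ᵒ)                           ≡⟨ cong (T a) pivotColumns-top ⟩
        T a (negSwap (T a (topOrbit k')))    ≡⟨ T-negSwap-T a (topOrbit k') ⟩
        negSwap (topOrbit k')                ≡⟨ columns-top 0 k' ⟨
        columns 0 k' ⊤ᵒ                      ∎)
      (λ x → begin
        roundPair a (p (inject₁ x))                           ≡⟨ roundPair-Backward a≥0 (p (inject₁ x)) (pivotColumns-Backward x) ⟩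
        (- proj₁ (p (inject₁ x)) , - proj₂ (p (inject₁ x)))   ≡⟨ cong (λ v → (- proj₁ v , - proj₂ v)) (pivotColumns-low x) ⟩
        (- - proj₁ (p₀ x) , - - proj₂ (p₀ x))                 ≡⟨ cong₂ _,_ (ℤ.neg-involutive _) (ℤ.neg-involutive _) ⟩
        p₀ x                                                  ≡⟨ columns-low 0 k' x ⟨
        columns 0 k' (inject₁ x)                              ∎)

  -- lastRound subtracts the form added by pivotRound, by T-adjointness.
  final≐M : Final k' γ₃ ≐ M
  final≐M = bordered-cong refl (λ _ → refl) (extend-cong e₀ closes)
    where
    closes : ∀ x → γ₃ x + - form a (lowOrbit k' x) (f₂ , f₁) ≡ f x
    closes x = begin
      f x + form a (p₀ x) (topOrbit k') + - form a (lowOrbit k' x) (f₂ , f₁)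
        ≡⟨ cong (λ z → f x + form a (p₀ x) (topOrbit k') + - z) (fold-adjoint (form a) (form-T a) (p₀ x) (f₂ , f₁) k') ⟩
      f x + form a (p₀ x) (topOrbit k') + - form a (p₀ x) (topOrbit k')
        ≡⟨ cancel (f x) (form a (p₀ x) (topOrbit k')) ⟩
      f x ∎
      where
      cancel : ∀ x y → x + y + - y ≡ x
      cancel = solve-∀

  midSequence : reverse (map inject₁ (allFin (suc (suc (suc m))))) ≡ reverse (tabulate lowᵥ) ++ v₂ ∷ v₁ ∷ []
  midSequence = begin
    reverse (map inject₁ (allFin (suc (suc (suc m)))))  ≡⟨ cong reverse (List.map-tabulate (λ i → i) inject₁) ⟩
    reverse (v₁ ∷ v₂ ∷ tabulate lowᵥ)                   ≡⟨ List.unfold-reverse v₁ (v₂ ∷ tabulate lowᵥ) ⟩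
    reverse (v₂ ∷ tabulate lowᵥ) ++ [ v₁ ]              ≡⟨ cong (_++ [ v₁ ]) (List.unfold-reverse v₂ (tabulate lowᵥ)) ⟩
    (reverse (tabulate lowᵥ) ++ [ v₂ ]) ++ [ v₁ ]       ≡⟨ List.++-assoc (reverse (tabulate lowᵥ)) [ v₂ ] [ v₁ ] ⟩
    reverse (tabulate lowᵥ) ++ v₂ ∷ v₁ ∷ []             ∎

  cycle : M ─[ cycleSeq n k ]→ M
  cycle = ─[]→-trans [ N ] (L₁₂ ++ L₀ ++ L₂₁) sinkAtN
    (─[]→-trans L₁₂ (L₀ ++ L₂₁)
      (subst (λ l → Stage k 0 f⁻ ─[ L₁₂ ]→ Stage 0 l f⁻) (ℕ.+-identityʳ k) (inverseRounds k 0 f⁻))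
    (─[]→-trans L₀ L₂₁
      (subst (λ ks → Stage 0 k f⁻ ─[ ks ]→ Stage 0 k' γ₃) (sym midSequence)
        (─[]→-trans (reverse (tabulate lowᵥ)) (v₂ ∷ v₁ ∷ []) sinks pivotRound))
      (─[]→-congʳ L₂₁ final≐M
        (subst (λ l → Stage 0 k' γ₃ ─[ L₂₁ ]→ Final l γ₃) (ℕ.+-identityʳ k') (forwardRounds k' 0 γ₃)))))
    where
    L₁₂ L₀ L₂₁ : List Vertex
    L₁₂ = concat (replicate k (v₁ ∷ v₂ ∷ []))
    L₀ = reverse (map inject₁ (allFin (suc (suc (suc m)))))
    L₂₁ = concat (replicate k (v₂ ∷ v₁ ∷ []))

module Member (m k' : ℕ) (Q : Quiv (suc (suc (suc (suc m))))) (R : Quiv (suc (suc (suc m))))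
  (R≥2 : ∀ c → + 2 ≤ℤ R c)
  (Q≈ : restrict Q ≈Q μs (concat (replicate (suc k') (v₂ ∷ v₁ ∷ []))) R)
  (lastCol≥2 : ∀ i → + 2 ≤ℤ lastCol Q i)
  where

  L₂₁ : List (Fin (suc (suc (suc m))))
  L₂₁ = concat (replicate (suc k') (v₂ ∷ v₁ ∷ []))

  a : ℤ
  a = bm R v₁ v₂

  pR : Fin (suc m) → ℤ × ℤ
  pR x = (bm R v₁ (other x) , bm R v₂ (other x))

  eR : Mat (suc m)
  eR x y = bm R (other x) (other y)

  a≥2 : + 2 ≤ℤ a
  a≥2 = bm-≥2 R≥2 (s≤s z≤n)

  pR≥ : ∀ x → 0ℤ ≤ℤ proj₁ (pR x) × + 1 ≤ℤ proj₂ (pR x)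
  pR≥ x = 2≤i⇒0≤i (bm-≥2 R≥2 (s≤s z≤n)) , 2≤i⇒1≤i (bm-≥2 R≥2 (s≤s (s≤s z≤n)))

  inner : ∀ i j → bm Q (inject₁ i) (inject₁ j) ≡ bordered a (λ x → fold (pR x) (T a) (suc k')) eR i j
  inner i j = begin
    bm Q (inject₁ i) (inject₁ j)      ≡⟨ bm-restrict Q i j ⟨
    bm (restrict Q) i j               ≡⟨ bm-cong Q≈ i j ⟩
    bm (μs L₂₁ R) i j                 ≡⟨ bm-μs L₂₁ R i j ⟩
    μᴹs L₂₁ (bm R) i j                ≡⟨ rounds-≥2 R R≥2 (suc k') i j ⟩
    bordered a (λ x → fold (pR x) (T a) (suc k')) eR i j ∎

  lastCol≥ : ∀ i → + 2 ≤ℤ bm Q (inject₁ i) (fromℕ (suc (suc (suc m))))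
  lastCol≥ i = subst (+ 2 ≤ℤ_) (sym (bm-lastCol Q i)) (lastCol≥2 i)

  open Cycle m a≥2 k' pR pR≥ eR (λ x y → bm-skew R (other x) (other y))
    (λ x y x<y → 2≤i⇒0≤i (bm-≥2 R≥2 (s≤s (s≤s x<y))))
    (bm Q v₁ (fromℕ _)) (bm Q v₂ (fromℕ _)) (2≤i⇒1≤i (lastCol≥ v₁)) (2≤i⇒0≤i (lastCol≥ v₂))
    (λ x → bm Q (other (inject₁ x)) (fromℕ _)) (λ x → 2≤i⇒0≤i (lastCol≥ (other x)))

  bmQ≐M : bm Q ≐ M
  bmQ≐M = ≐-trans (Skew⇒bordered (bm-skew Q)) (bordered-cong (inner v₁ v₂) columns≡ block≡)
    where
    columns≡ : ∀ r → (bm Q v₁ (other r) , bm Q v₂ (other r)) ≡ initialColumns r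
    columns≡ = top-or-low {P = λ r → (bm Q v₁ (other r) , bm Q v₂ (other r)) ≡ initialColumns r}
      (sym (caseTop-top (bm Q v₁ N , bm Q v₂ N) (lowOrbit k)))
      (λ x → trans (cong₂ _,_ (inner v₁ (other x)) (inner v₂ (other x)))
                   (sym (caseTop-low (bm Q v₁ N , bm Q v₂ N) (lowOrbit k) x)))
    block≡ : (λ r s → bm Q (other r) (other s)) ≐ extend eR (λ x → bm Q (lowᵥ x) N)
    block≡ = top-or-low₂ {P = λ r s → bm Q (other r) (other s) ≡ extend eR (λ x → bm Q (lowᵥ x) N) r s}
      (trans (Skew⇒diag≡0 (bm-skew Q) N) (sym (extend-top-top eR _)))
      (λ y → trans (bm-skew Q (lowᵥ y) N) (sym (extend-top-low eR _ y)))
      (λ x → sym (extend-low-top eR _ x))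
      (λ x y → trans (inner (other x) (other y)) (sym (extend-low-low eR _ x y)))

  isMutationCycle : CycDistinct (cycleSeq (suc (suc (suc (suc m)))) (suc k')) →
    IsMutationCycle (cycleSeq (suc (suc (suc (suc m)))) (suc k')) Q
  isMutationCycle distinct = ─[]→⇒IsMutationCycle Q distinct
    (─[]→-congˡ (cycleSeq _ (suc k')) (≐-sym bmQ≐M) (─[]→-congʳ (cycleSeq _ (suc k')) (≐-sym bmQ≐M) cycle))

Linked⇒ConsecDistinct : ∀ {A : Set} {xs : List A} → Linked _≢_ xs → ConsecDistinct xs
Linked⇒ConsecDistinct [] = tt
Linked⇒ConsecDistinct [-] = tt
Linked⇒ConsecDistinct (x≢y ∷ rest) = x≢y , Linked⇒ConsecDistinct rest

module _ {A : Set} where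

  last-∷ʳ : ∀ (xs : List A) x → last (xs ∷ʳ x) ≡ just x
  last-∷ʳ [] x = refl
  last-∷ʳ (y ∷ []) x = refl
  last-∷ʳ (y ∷ y' ∷ ys) x = last-∷ʳ (y' ∷ ys) x

  last-reverse : ∀ (xs : List A) → last (reverse xs) ≡ head xs
  last-reverse [] = refl
  last-reverse (x ∷ xs) = trans (cong last (List.unfold-reverse x xs)) (last-∷ʳ (reverse xs) x)

  head-reverse : ∀ (xs : List A) → head (reverse xs) ≡ last xs
  head-reverse xs = trans (sym (last-reverse (reverse xs))) (cong last (List.reverse-involutive xs))

  head-++ : ∀ {x} (xs ys : List A) → head xs ≡ just x → head (xs ++ ys) ≡ just x
  head-++ (x ∷ xs) ys head≡ = head≡

  last-tabulate : ∀ {n} (f : Fin (suc n) → A) → last (tabulate f) ≡ just (f (fromℕ n))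
  last-tabulate {zero} f = refl
  last-tabulate {suc n} f = last-tabulate (λ i → f (fs i))

  last-alternating : ∀ {x y : A} j → last (concat (replicate (suc j) (x ∷ y ∷ []))) ≡ just y
  last-alternating zero = refl
  last-alternating (suc j) = last-alternating j

  connected : ∀ {R : A → A → Set} {x y} {xs ys : List A} →
    last xs ≡ just x → head ys ≡ just y → R x y → Connected R (last xs) (head ys)
  connected last≡ head≡ Rxy = subst₂ (Connected _) (sym last≡) (sym head≡) (just Rxy)

  Linked-reverse : ∀ {R : A → A → Set} → (∀ {x y} → R x y → R y x) → ∀ {xs} → Linked R xs → Linked R (reverse xs)
  Linked-reverse R-sym [] = []
  Linked-reverse R-sym [-] = [-]
  Linked-reverse {R} R-sym {x ∷ y ∷ ys} (Rxy ∷ rest) = subst (Linked R) (sym (List.unfold-reverse x (y ∷ ys)))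
    (Linked.++⁺ (Linked-reverse R-sym rest)
      (connected {xs = reverse (y ∷ ys)} {ys = [ x ]} (last-reverse (y ∷ ys)) refl (R-sym Rxy)) [-])

  Linked-alternating : ∀ {x y : A} → x ≢ y → ∀ j → Linked _≢_ (concat (replicate j (x ∷ y ∷ [])))
  Linked-alternating x≢y zero = []
  Linked-alternating x≢y (suc zero) = x≢y ∷ [-]
  Linked-alternating x≢y (suc (suc j)) = x≢y ∷ (≢-sym x≢y ∷ Linked-alternating x≢y (suc j))

cycleSeq-distinct : ∀ m k' → CycDistinct (cycleSeq (suc (suc (suc (suc m)))) (suc k'))
cycleSeq-distinct m k' = Linked⇒ConsecDistinct (just (λ ()) ∷′ subst (Linked _≢_) reassoc
  (Linked.++⁺ (Linked-alternating (λ ()) (suc k')) (connected {xs = L₁₂} (last-alternating k') head-L₀ (λ ()))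
  (Linked.++⁺ L₀-linked (connected {xs = L₀} {ys = L₂₁ ++ [ N ]} last-L₀ refl (λ ()))
  (Linked.++⁺ (Linked-alternating (λ ()) (suc k'))
    (connected {xs = L₂₁} {ys = [ N ]} (last-alternating k') refl (λ ())) [-]))))
  where
  Vertex : Set
  Vertex = Fin (suc (suc (suc (suc m))))
  N : Vertex
  N = fromℕ (suc (suc (suc m)))
  L₁₂ L₀ L₂₁ : List Vertex
  L₁₂ = concat (replicate (suc k') (v₁ ∷ v₂ ∷ []))
  L₀ = reverse (map inject₁ (allFin (suc (suc (suc m)))))
  L₂₁ = concat (replicate (suc k') (v₂ ∷ v₁ ∷ []))
  reassoc : L₁₂ ++ L₀ ++ L₂₁ ++ [ N ] ≡ (L₁₂ ++ L₀ ++ L₂₁) ++ [ N ]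
  reassoc = trans (cong (L₁₂ ++_) (sym (List.++-assoc L₀ L₂₁ [ N ]))) (sym (List.++-assoc L₁₂ (L₀ ++ L₂₁) [ N ]))
  L₀-linked : Linked _≢_ L₀
  L₀-linked = Linked-reverse ≢-sym (Linked.AllPairs⇒Linked (Unique.map⁺ Fin.inject₁-injective (Unique.allFin⁺ _)))
  head-L₀ : head (L₀ ++ L₂₁ ++ [ N ]) ≡ just (inject₁ (fromℕ (suc (suc m))))
  head-L₀ = head-++ L₀ (L₂₁ ++ [ N ]) (begin
    head L₀                                         ≡⟨ head-reverse (map inject₁ (allFin (suc (suc (suc m))))) ⟩
    last (map inject₁ (allFin (suc (suc (suc m)))))  ≡⟨ cong last (List.map-tabulate (λ i → i) inject₁) ⟩
    last (tabulate inject₁)                         ≡⟨ last-tabulate inject₁ ⟩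
    just (inject₁ (fromℕ (suc (suc m))))            ∎)
  last-L₀ : last L₀ ≡ just v₁
  last-L₀ = last-reverse (map inject₁ (allFin (suc (suc (suc m)))))

module _ {V : Set} where

  negᴾ : Poly V → Poly V
  negᴾ p = con (- + 1) ⊗ p

  Tᴾ : Poly V → Poly V × Poly V → Poly V × Poly V
  Tᴾ a (c , d) = (negᴾ (c ⊕ (a ⊗ d)) , negᴾ d ⊕ (a ⊗ (c ⊕ (a ⊗ d))))

  T⁻¹ᴾ : Poly V → Poly V × Poly V → Poly V × Poly V
  T⁻¹ᴾ a (c , d) = ((((a ⊗ a) ⊕ con (- + 1)) ⊗ c) ⊕ (a ⊗ d) , negᴾ d ⊕ negᴾ (a ⊗ c))

  evalPair : Poly V × Poly V → (V → ℤ) → ℤ × ℤ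
  evalPair (p , q) x = (eval p x , eval q x)

  eval-negᴾ : ∀ p x → eval (negᴾ p) x ≡ - eval p x
  eval-negᴾ p x = ℤ.-1*i≡-i (eval p x)

  eval-Tᴾ : ∀ a x v → evalPair (Tᴾ a v) x ≡ T (eval a x) (evalPair v x)
  eval-Tᴾ a x (c , d) = cong₂ _,_ (eval-negᴾ (c ⊕ (a ⊗ d)) x)
    (cong (_+ eval a x * (eval c x + eval a x * eval d x)) (eval-negᴾ d x))

  eval-T⁻¹ᴾ : ∀ a x v → evalPair (T⁻¹ᴾ a v) x ≡ T⁻¹ (eval a x) (evalPair v x)
  eval-T⁻¹ᴾ a x (c , d) = cong (proj₁ (T⁻¹ (eval a x) (eval c x , eval d x)) ,_)
    (cong₂ _+_ (eval-negᴾ d x) (eval-negᴾ (a ⊗ c) x))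

  eval-fold-Tᴾ : ∀ a x v n → evalPair (fold v (Tᴾ a) n) x ≡ fold (evalPair v x) (T (eval a x)) n
  eval-fold-Tᴾ a x = fold-map (λ v → evalPair v x) (eval-Tᴾ a x)

  eval-fold-T⁻¹ᴾ : ∀ a x v n → evalPair (fold v (T⁻¹ᴾ a) n) x ≡ fold (evalPair v x) (T⁻¹ (eval a x)) n
  eval-fold-T⁻¹ᴾ a x = fold-map (λ v → evalPair v x) (eval-T⁻¹ᴾ a x)

-- fwd x has b_ij = 2 + x_ij, except that the columns (b₁ᵣ, b₂ᵣ) at r = 3, …, n − 1 are Tᵏ of these
-- (with a = 2 + x₁₂); bwd subtracts 2 after applying T⁻ᵏ.
module Parametrization (m k' : ℕ) where

  k : ℕ
  k = suc k'

  Coordinate : Set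
  Coordinate = Coord (suc (suc (suc (suc m))))

  c₁₂ : Coordinate
  c₁₂ = ((v₁ , v₂) , s≤s z≤n)

  c₁ c₂ : Fin (suc (suc m)) → Coordinate
  c₁ r = ((v₁ , other r) , s≤s z≤n)
  c₂ r = ((v₂ , other r) , s≤s (s≤s z≤n))

  shifted unshifted : Coordinate → Poly Coordinate
  shifted c = con (+ 2) ⊕ var c
  unshifted c = var c ⊕ con (- + 2)

  lowPairᴾ lowPair⁻ᴾ : Fin (suc (suc m)) → Poly Coordinate × Poly Coordinate
  lowPairᴾ r = fold (shifted (c₁ r) , shifted (c₂ r)) (Tᴾ (shifted c₁₂)) k
  lowPair⁻ᴾ r = fold (var (c₁ r) , var (c₂ r)) (T⁻¹ᴾ (var c₁₂)) k

  fwd : PolyMap Coordinate Coordinate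
  fwd ((v₁ , v₁) , ())
  fwd c@((v₁ , other r) , _) = caseTop (shifted c) (λ _ → proj₁ (lowPairᴾ r)) r
  fwd c@((v₂ , other r) , _) = caseTop (shifted c) (λ _ → proj₂ (lowPairᴾ r)) r
  fwd c = shifted c

  bwd : PolyMap Coordinate Coordinate
  bwd ((v₁ , v₁) , ())
  bwd c@((v₁ , other r) , _) = caseTop (unshifted c) (λ _ → proj₁ (lowPair⁻ᴾ r) ⊕ con (- + 2)) r
  bwd c@((v₂ , other r) , _) = caseTop (unshifted c) (λ _ → proj₂ (lowPair⁻ᴾ r) ⊕ con (- + 2)) r
  bwd c = unshifted c

  lowPair lowPair⁻ : (Coordinate → ℤ) → Fin (suc (suc m)) → ℤ × ℤ
  lowPair x r = fold (+ 2 + x (c₁ r) , + 2 + x (c₂ r)) (T (+ 2 + x c₁₂)) k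
  lowPair⁻ y r = fold (y (c₁ r) , y (c₂ r)) (T⁻¹ (y c₁₂)) k

  ⊤ᵒ : Fin (suc (suc m))
  ⊤ᵒ = fromℕ (suc m)

  module _ (x : Coordinate → ℤ) where

    fwd-v₁-top : ∀ p → evalMap fwd x ((v₁ , other ⊤ᵒ) , p) ≡ + 2 + x ((v₁ , other ⊤ᵒ) , p)
    fwd-v₁-top p = cong (λ q → eval q x) (caseTop-top {suc m} (shifted ((v₁ , other ⊤ᵒ) , p)) (λ _ → proj₁ (lowPairᴾ ⊤ᵒ)))

    fwd-v₂-top : ∀ p → evalMap fwd x ((v₂ , other ⊤ᵒ) , p) ≡ + 2 + x ((v₂ , other ⊤ᵒ) , p)
    fwd-v₂-top p = cong (λ q → eval q x) (caseTop-top {suc m} (shifted ((v₂ , other ⊤ᵒ) , p)) (λ _ → proj₂ (lowPairᴾ ⊤ᵒ)))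

    fwd-low : ∀ y → (evalMap fwd x (c₁ (inject₁ y)) , evalMap fwd x (c₂ (inject₁ y))) ≡ lowPair x (inject₁ y)
    fwd-low y = trans
      (cong₂ (λ p q → (eval p x , eval q x))
        (caseTop-low (shifted (c₁ (inject₁ y))) (λ _ → proj₁ (lowPairᴾ (inject₁ y))) y)
        (caseTop-low (shifted (c₂ (inject₁ y))) (λ _ → proj₂ (lowPairᴾ (inject₁ y))) y))
      (eval-fold-Tᴾ (shifted c₁₂) x (shifted (c₁ (inject₁ y)) , shifted (c₂ (inject₁ y))) k)

    bwd-v₁-top : ∀ p → evalMap bwd x ((v₁ , other ⊤ᵒ) , p) ≡ x ((v₁ , other ⊤ᵒ) , p) + - + 2
    bwd-v₁-top p = cong (λ q → eval q x)
      (caseTop-top {suc m} (unshifted ((v₁ , other ⊤ᵒ) , p)) (λ _ → proj₁ (lowPair⁻ᴾ ⊤ᵒ) ⊕ con (- + 2)))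

    bwd-v₂-top : ∀ p → evalMap bwd x ((v₂ , other ⊤ᵒ) , p) ≡ x ((v₂ , other ⊤ᵒ) , p) + - + 2
    bwd-v₂-top p = cong (λ q → eval q x)
      (caseTop-top {suc m} (unshifted ((v₂ , other ⊤ᵒ) , p)) (λ _ → proj₂ (lowPair⁻ᴾ ⊤ᵒ) ⊕ con (- + 2)))

    bwd-low : ∀ y → (evalMap bwd x (c₁ (inject₁ y)) , evalMap bwd x (c₂ (inject₁ y))) ≡
      (proj₁ (lowPair⁻ x (inject₁ y)) + - + 2 , proj₂ (lowPair⁻ x (inject₁ y)) + - + 2)
    bwd-low y = trans
      (cong₂ (λ p q → (eval p x , eval q x))
        (caseTop-low (unshifted (c₁ (inject₁ y))) (λ _ → proj₁ (lowPair⁻ᴾ (inject₁ y)) ⊕ con (- + 2)) y)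
        (caseTop-low (unshifted (c₂ (inject₁ y))) (λ _ → proj₂ (lowPair⁻ᴾ (inject₁ y)) ⊕ con (- + 2)) y))
      (cong (λ v → (proj₁ v + - + 2 , proj₂ v + - + 2))
        (eval-fold-T⁻¹ᴾ (var c₁₂) x (var (c₁ (inject₁ y)) , var (c₂ (inject₁ y))) k))

  unshift-shift : ∀ z → + 2 + z + - + 2 ≡ z
  unshift-shift = solve-∀

  shift-unshift : ∀ z → + 2 + (z + - + 2) ≡ z
  shift-unshift = solve-∀

  lowPair⁻∘fwd : ∀ x y → lowPair⁻ (evalMap fwd x) (inject₁ y) ≡ (+ 2 + x (c₁ (inject₁ y)) , + 2 + x (c₂ (inject₁ y)))
  lowPair⁻∘fwd x y = trans (cong (λ v → fold v (T⁻¹ (+ 2 + x c₁₂)) k) (fwd-low x y))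
    (fold-inverse {f = T (+ 2 + x c₁₂)} {g = T⁻¹ (+ 2 + x c₁₂)} (T⁻¹∘T (+ 2 + x c₁₂))
      (+ 2 + x (c₁ (inject₁ y)) , + 2 + x (c₂ (inject₁ y))) k)

  lowPair∘bwd : ∀ y r → lowPair (evalMap bwd y) (inject₁ r) ≡ (y (c₁ (inject₁ r)) , y (c₂ (inject₁ r)))
  lowPair∘bwd y r = begin
    fold (+ 2 + G (c₁ (inject₁ r)) , + 2 + G (c₂ (inject₁ r))) (T (+ 2 + G c₁₂)) k
      ≡⟨ cong₂ (λ v a → fold v (T a) k)
           (trans (cong (λ v → (+ 2 + proj₁ v , + 2 + proj₂ v)) (bwd-low y r))
                  (cong₂ _,_ (shift-unshift _) (shift-unshift _)))
           (shift-unshift (y c₁₂)) ⟩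
    fold (lowPair⁻ y (inject₁ r)) (T (y c₁₂)) k
      ≡⟨ fold-inverse {f = T⁻¹ (y c₁₂)} {g = T (y c₁₂)} (T∘T⁻¹ (y c₁₂)) (y (c₁ (inject₁ r)) , y (c₂ (inject₁ r))) k ⟩
    (y (c₁ (inject₁ r)) , y (c₂ (inject₁ r))) ∎
    where
    G : Coordinate → ℤ
    G = evalMap bwd y

  bwd∘fwd : ∀ x c → evalMap bwd (evalMap fwd x) c ≡ x c
  bwd∘fwd x ((v₁ , v₁) , ())
  bwd∘fwd x ((v₁ , v₂) , p) = unshift-shift (x ((v₁ , v₂) , p))
  bwd∘fwd x ((v₁ , other r) , p) =
    top-or-low {P = λ r → ∀ p → evalMap bwd (evalMap fwd x) ((v₁ , other r) , p) ≡ x ((v₁ , other r) , p)}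
      (λ p → trans (bwd-v₁-top (evalMap fwd x) p) (trans (cong (_+ - + 2) (fwd-v₁-top x p)) (unshift-shift _)))
      (λ y p → begin
        evalMap bwd (evalMap fwd x) ((v₁ , other (inject₁ y)) , p)  ≡⟨ coord-irrelevant (evalMap bwd (evalMap fwd x)) p _ ⟩
        evalMap bwd (evalMap fwd x) (c₁ (inject₁ y))                ≡⟨ cong proj₁ (bwd-low (evalMap fwd x) y) ⟩
        proj₁ (lowPair⁻ (evalMap fwd x) (inject₁ y)) + - + 2         ≡⟨ cong (λ v → proj₁ v + - + 2) (lowPair⁻∘fwd x y) ⟩
        + 2 + x (c₁ (inject₁ y)) + - + 2                             ≡⟨ unshift-shift _ ⟩
        x (c₁ (inject₁ y))                                          ≡⟨ coord-irrelevant x _ p ⟩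
        x ((v₁ , other (inject₁ y)) , p)                            ∎)
      r p
  bwd∘fwd x ((v₂ , v₁) , ())
  bwd∘fwd x ((v₂ , v₂) , s≤s ())
  bwd∘fwd x ((v₂ , other r) , p) =
    top-or-low {P = λ r → ∀ p → evalMap bwd (evalMap fwd x) ((v₂ , other r) , p) ≡ x ((v₂ , other r) , p)}
      (λ p → trans (bwd-v₂-top (evalMap fwd x) p) (trans (cong (_+ - + 2) (fwd-v₂-top x p)) (unshift-shift _)))
      (λ y p → begin
        evalMap bwd (evalMap fwd x) ((v₂ , other (inject₁ y)) , p)  ≡⟨ coord-irrelevant (evalMap bwd (evalMap fwd x)) p _ ⟩
        evalMap bwd (evalMap fwd x) (c₂ (inject₁ y))                ≡⟨ cong proj₂ (bwd-low (evalMap fwd x) y) ⟩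
        proj₂ (lowPair⁻ (evalMap fwd x) (inject₁ y)) + - + 2         ≡⟨ cong (λ v → proj₂ v + - + 2) (lowPair⁻∘fwd x y) ⟩
        + 2 + x (c₂ (inject₁ y)) + - + 2                             ≡⟨ unshift-shift _ ⟩
        x (c₂ (inject₁ y))                                          ≡⟨ coord-irrelevant x _ p ⟩
        x ((v₂ , other (inject₁ y)) , p)                            ∎)
      r p
  bwd∘fwd x ((other i , j) , p) = unshift-shift (x ((other i , j) , p))

  fwd∘bwd : ∀ y c → evalMap fwd (evalMap bwd y) c ≡ y c
  fwd∘bwd y ((v₁ , v₁) , ())
  fwd∘bwd y ((v₁ , v₂) , p) = shift-unshift (y ((v₁ , v₂) , p))
  fwd∘bwd y ((v₁ , other r) , p) =
    top-or-low {P = λ r → ∀ p → evalMap fwd (evalMap bwd y) ((v₁ , other r) , p) ≡ y ((v₁ , other r) , p)}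
      (λ p → trans (fwd-v₁-top (evalMap bwd y) p) (trans (cong (λ z → + 2 + z) (bwd-v₁-top y p)) (shift-unshift _)))
      (λ r p → begin
        evalMap fwd (evalMap bwd y) ((v₁ , other (inject₁ r)) , p)  ≡⟨ coord-irrelevant (evalMap fwd (evalMap bwd y)) p _ ⟩
        evalMap fwd (evalMap bwd y) (c₁ (inject₁ r))                ≡⟨ cong proj₁ (fwd-low (evalMap bwd y) r) ⟩
        proj₁ (lowPair (evalMap bwd y) (inject₁ r))                 ≡⟨ cong proj₁ (lowPair∘bwd y r) ⟩
        y (c₁ (inject₁ r))                                          ≡⟨ coord-irrelevant y _ p ⟩
        y ((v₁ , other (inject₁ r)) , p)                            ∎)
      r p
  fwd∘bwd y ((v₂ , v₁) , ())
  fwd∘bwd y ((v₂ , v₂) , s≤s ())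
  fwd∘bwd y ((v₂ , other r) , p) =
    top-or-low {P = λ r → ∀ p → evalMap fwd (evalMap bwd y) ((v₂ , other r) , p) ≡ y ((v₂ , other r) , p)}
      (λ p → trans (fwd-v₂-top (evalMap bwd y) p) (trans (cong (λ z → + 2 + z) (bwd-v₂-top y p)) (shift-unshift _)))
      (λ r p → begin
        evalMap fwd (evalMap bwd y) ((v₂ , other (inject₁ r)) , p)  ≡⟨ coord-irrelevant (evalMap fwd (evalMap bwd y)) p _ ⟩
        evalMap fwd (evalMap bwd y) (c₂ (inject₁ r))                ≡⟨ cong proj₂ (fwd-low (evalMap bwd y) r) ⟩
        proj₂ (lowPair (evalMap bwd y) (inject₁ r))                 ≡⟨ cong proj₂ (lowPair∘bwd y r) ⟩
        y (c₂ (inject₁ r))                                          ≡⟨ coord-irrelevant y _ p ⟩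
        y ((v₂ , other (inject₁ r)) , p)                            ∎)
      r p
  fwd∘bwd y ((other i , j) , p) = shift-unshift (y ((other i , j) , p))

  unshift≥0 : ∀ {z} → + 2 ≤ℤ z → 0ℤ ≤ℤ z + - + 2
  unshift≥0 = ℤ.i≤j⇒0≤j-i

  shiftedQuiver : (Coordinate → ℤ) → Quiv (suc (suc (suc m)))
  shiftedQuiver x = restrict (λ c → + 2 + x c)

  module _ (x : Coordinate → ℤ) where

    bm-shifted : ∀ {i j} (i<j : toℕ i ℕ.< toℕ j) q → bm (shiftedQuiver x) i j ≡ + 2 + x ((inject₁ i , inject₁ j) , q)
    bm-shifted i<j q = trans (bm-< (shiftedQuiver x) i<j) (cong (λ z → + 2 + z) (coord-irrelevant x _ q))

    lowPair-shifted : ∀ r → let R = shiftedQuiver x in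
      fold (bm R v₁ (other r) , bm R v₂ (other r)) (T (bm R v₁ v₂)) k ≡ lowPair x (inject₁ r)
    lowPair-shifted r = cong₂ (λ v a → fold v (T a) k)
      (cong₂ _,_ (bm-shifted (s≤s z≤n) (s≤s z≤n)) (bm-shifted (s≤s (s≤s z≤n)) (s≤s (s≤s z≤n))))
      (bm-shifted (s≤s z≤n) (s≤s z≤n))

    shiftedAfterRounds : Mat (suc (suc (suc m)))
    shiftedAfterRounds = let R = shiftedQuiver x in
      bordered (bm R v₁ v₂) (λ r → fold (bm R v₁ (other r) , bm R v₂ (other r)) (T (bm R v₁ v₂)) k)
        (λ r s → bm R (other r) (other s))

    bm-fwd : (λ i j → bm (evalMap fwd x) (inject₁ i) (inject₁ j)) ≐ shiftedAfterRounds
    bm-fwd = Skew-≐ (λ i j → bm-skew Q (inject₁ i) (inject₁ j))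
      (bordered-skew _ _ (λ r s → bm-skew (shiftedQuiver x) (other r) (other s))) upper
      where
      Q : Coordinate → ℤ
      Q = evalMap fwd x
      upper : ∀ i j → toℕ i ℕ.< toℕ j → bm Q (inject₁ i) (inject₁ j) ≡ shiftedAfterRounds i j
      upper v₁ v₂ _ = trans (bm-< Q {v₁} {v₂} (s≤s z≤n)) (sym (bm-shifted (s≤s z≤n) (s≤s z≤n)))
      upper v₁ (other r) _ = trans (bm-< Q {v₁} {other (inject₁ r)} (s≤s z≤n))
        (trans (cong proj₁ (fwd-low x r)) (sym (cong proj₁ (lowPair-shifted r))))
      upper v₂ (other r) _ = trans (bm-< Q {v₂} {other (inject₁ r)} (s≤s (s≤s z≤n)))
        (trans (cong proj₂ (fwd-low x r)) (sym (cong proj₂ (lowPair-shifted r))))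
      upper (other i) (other j) i<j = trans (bm-< Q {other (inject₁ i)} {other (inject₁ j)} lifted)
        (sym (bm-shifted i<j lifted))
        where
        lifted : toℕ (other (inject₁ i)) ℕ.< toℕ (other (inject₁ j))
        lifted = s≤s (s≤s (subst₂ ℕ._<_ (sym (Fin.toℕ-inject₁ i)) (sym (Fin.toℕ-inject₁ j)) (ℕ.s<s⁻¹ (ℕ.s<s⁻¹ i<j))))
      upper v₁ v₁ ()
      upper v₂ v₁ ()
      upper v₂ v₂ (s≤s ())
      upper (other i) v₁ ()
      upper (other i) v₂ (s≤s ())

  fwd-into : ∀ x → NonNeg x → 𝐐 (suc (suc (suc (suc m)))) k (evalMap fwd x)
  fwd-into x x≥0 = shiftedQuiver x , R≥2 , restrict≈ , lastCol≥2
    where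
    Q : Coordinate → ℤ
    Q = evalMap fwd x
    R : Quiv (suc (suc (suc m)))
    R = shiftedQuiver x
    L₂₁ : List (Fin (suc (suc (suc m))))
    L₂₁ = concat (replicate k (v₂ ∷ v₁ ∷ []))
    R≥2 : ∀ c → + 2 ≤ℤ R c
    R≥2 c = 0≤i⇒2≤2+i (x≥0 _)
    restrict≈ : restrict Q ≈Q μs L₂₁ R
    restrict≈ ((i , j) , i<j) = begin
      restrict Q ((i , j) , i<j)      ≡⟨ bm-< (restrict Q) i<j ⟨
      bm (restrict Q) i j            ≡⟨ bm-restrict Q i j ⟩
      bm Q (inject₁ i) (inject₁ j)   ≡⟨ bm-fwd x i j ⟩
      shiftedAfterRounds x i j       ≡⟨ rounds-≥2 R R≥2 k i j ⟨
      μᴹs L₂₁ (bm R) i j             ≡⟨ bm-μs L₂₁ R i j ⟨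
      bm (μs L₂₁ R) i j              ≡⟨ bm-< (μs L₂₁ R) i<j ⟩
      μs L₂₁ R ((i , j) , i<j)       ∎
    lastCol≥2 : ∀ i → + 2 ≤ℤ lastCol Q i
    lastCol≥2 v₁ = subst (+ 2 ≤ℤ_) (sym (fwd-v₁-top x _)) (0≤i⇒2≤2+i (x≥0 _))
    lastCol≥2 v₂ = subst (+ 2 ≤ℤ_) (sym (fwd-v₂-top x _)) (0≤i⇒2≤2+i (x≥0 _))
    lastCol≥2 (other i) = 0≤i⇒2≤2+i (x≥0 _)

  module _ (y : Coordinate → ℤ) (R : Quiv (suc (suc (suc m)))) (R≥2 : ∀ c → + 2 ≤ℤ R c)
    (y≈ : restrict y ≈Q μs (concat (replicate k (v₂ ∷ v₁ ∷ []))) R) (lastCol≥2 : ∀ i → + 2 ≤ℤ lastCol y i)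
    where

    open Member m k' y R R≥2 y≈ lastCol≥2 using (a; pR; inner; a≥2)

    y-lastCol≥2 : ∀ i {p} → + 2 ≤ℤ y ((inject₁ i , fromℕ (suc (suc (suc m)))) , p)
    y-lastCol≥2 i = subst (+ 2 ≤ℤ_) (coord-irrelevant y _ _) (lastCol≥2 i)

    lowPair⁻-member : ∀ r → lowPair⁻ y (inject₁ r) ≡ pR r
    lowPair⁻-member r = begin
      fold (y (c₁ (inject₁ r)) , y (c₂ (inject₁ r))) (T⁻¹ (y c₁₂)) k
        ≡⟨ cong₂ (λ v a → fold v (T⁻¹ a) k)
             (cong₂ _,_ (trans (sym (bm-< y (s≤s z≤n))) (inner v₁ (other r)))
                        (trans (sym (bm-< y (s≤s (s≤s z≤n)))) (inner v₂ (other r))))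
             (trans (sym (bm-< y (s≤s z≤n))) (inner v₁ v₂)) ⟩
      fold (fold (pR r) (T a) k) (T⁻¹ a) k
        ≡⟨ fold-inverse {f = T a} {g = T⁻¹ a} (T⁻¹∘T a) (pR r) k ⟩
      pR r ∎

    y-block≥2 : ∀ i j p → + 2 ≤ℤ y ((other i , other j) , p)
    y-block≥2 = top-or-low₂ {P = λ i j → ∀ p → + 2 ≤ℤ y ((other i , other j) , p)}
      (λ p → ⊥-elim (ℕ.<-irrefl refl (ℕ.s<s⁻¹ (ℕ.s<s⁻¹ p))))
      (λ j p → ⊥-elim (ℕ.<⇒≱ (ℕ.s<s⁻¹ (ℕ.s<s⁻¹ p))
        (subst (toℕ (inject₁ j) ℕ.≤_) (sym (Fin.toℕ-fromℕ (suc m))) (Fin.toℕ≤pred[n] (inject₁ j)))))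
      (λ i p → y-lastCol≥2 (other i))
      (λ i j p → subst (+ 2 ≤ℤ_) (sym (trans (sym (bm-< y p)) (inner (other i) (other j))))
        (bm-≥2 R≥2 (s≤s (s≤s (subst₂ ℕ._<_ (Fin.toℕ-inject₁ i) (Fin.toℕ-inject₁ j) (ℕ.s<s⁻¹ (ℕ.s<s⁻¹ p)))))))

    bwd-member≥0 : NonNeg (evalMap bwd y)
    bwd-member≥0 ((v₁ , v₁) , ())
    bwd-member≥0 ((v₁ , v₂) , p) = unshift≥0 (subst (+ 2 ≤ℤ_) (sym (trans (sym (bm-< y p)) (inner v₁ v₂))) a≥2)
    bwd-member≥0 ((v₁ , other r) , p) = top-or-low {P = λ r → ∀ p → 0ℤ ≤ℤ evalMap bwd y ((v₁ , other r) , p)}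
      (λ p → subst (0ℤ ≤ℤ_) (sym (bwd-v₁-top y p)) (unshift≥0 (y-lastCol≥2 v₁)))
      (λ r p → subst (0ℤ ≤ℤ_)
        (sym (trans (coord-irrelevant (evalMap bwd y) p _)
                    (trans (cong proj₁ (bwd-low y r)) (cong (λ v → proj₁ v + - + 2) (lowPair⁻-member r)))))
        (unshift≥0 (bm-≥2 R≥2 (s≤s z≤n))))
      r p
    bwd-member≥0 ((v₂ , v₁) , ())
    bwd-member≥0 ((v₂ , v₂) , s≤s ())
    bwd-member≥0 ((v₂ , other r) , p) = top-or-low {P = λ r → ∀ p → 0ℤ ≤ℤ evalMap bwd y ((v₂ , other r) , p)}
      (λ p → subst (0ℤ ≤ℤ_) (sym (bwd-v₂-top y p)) (unshift≥0 (y-lastCol≥2 v₂)))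
      (λ r p → subst (0ℤ ≤ℤ_)
        (sym (trans (coord-irrelevant (evalMap bwd y) p _)
                    (trans (cong proj₂ (bwd-low y r)) (cong (λ v → proj₂ v + - + 2) (lowPair⁻-member r)))))
        (unshift≥0 (bm-≥2 R≥2 (s≤s (s≤s z≤n)))))
      r p
    bwd-member≥0 ((other i , v₁) , ())
    bwd-member≥0 ((other i , v₂) , s≤s ())
    bwd-member≥0 ((other i , other j) , p) = unshift≥0 (y-block≥2 i j p)

  bwd-into : ∀ y → 𝐐 (suc (suc (suc (suc m)))) k y → NonNeg (evalMap bwd y)
  bwd-into y (R , R≥2 , y≈ , lastCol≥2) = bwd-member≥0 y R R≥2 y≈ lastCol≥2

  biregular : ZBiregular NonNeg (𝐐 (suc (suc (suc (suc m)))) k)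
  biregular = record
    { fwd = fwd ; bwd = bwd ; fwd-into = fwd-into ; bwd-into = bwd-into
    ; bwd∘fwd = λ x _ → bwd∘fwd x ; fwd∘bwd = λ y _ → fwd∘bwd y }

  fullyGeneric : FullyGeneric (suc (suc (suc (suc m)))) (𝐐 (suc (suc (suc (suc m)))) k)
  fullyGeneric = 𝐐 _ k , (λ _ Q∈𝐐 → Q∈𝐐) , biregular

theorem8p18 : (n k : ℕ) → 4 ≤ n → 1 ≤ k →
    FullyGeneric n (𝐐 n k) × FullyGenericMutationCycle n (𝐐 n k) (cycleSeq n k)
theorem8p18 (suc (suc (suc (suc m)))) (suc k') _ _ =
  fullyGeneric , fullyGeneric , λ Q (R , R≥2 , Q≈ , lastCol≥2) →
    Member.isMutationCycle m k' Q R R≥2 Q≈ lastCol≥2 (cycleSeq-distinct m k')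
  where
  open Parametrization m k' using (fullyGeneric)
theorem8p18 (suc (suc (suc (suc m)))) zero _ ()
theorem8p18 zero _ () _
theorem8p18 (suc zero) _ (s≤s ()) _
theorem8p18 (suc (suc zero)) _ (s≤s (s≤s ())) _
theorem8p18 (suc (suc (suc zero))) _ (s≤s (s≤s (s≤s ()))) _
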